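{- Let $T:\mathbb{Z}_2\to\mathbb{Z}_2$ be the Collatz map on the $2$-adic integers, $T(f)=f/2$ if $f\equiv 0 \pmod 2$ and $T(f)=3f+1$ otherwise. For every $n\ge 1$, the number $Z_n$ of $T$-cycles of length $n$ in $\mathbb{Z}_2$ is finite and equals $$Z_n=\frac1n\sum_{d\mid n}\mu(d)\left(\phi^{n/d}+\psi^{n/d}\right),\qquad \phi=\frac{1+\sqrt5}{2},\ \psi=\frac{1-\sqrt5}{2}.$$ Moreover $Z_n\sim \frac{\phi^n}{n}$ as $n\to\infty$.
   Context: An element $f\in\mathbb{Z}_2$ is $T$-periodic if $T^k(f)=f$ for some $k\ge1$; the minimal such $k$ is its period, and its orbit is a $T$-cycle of length equal to the period. $\mu$ is the Möbius function. -}

module Defs where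

open import Data.Bool using (Bool; true; false; if_then_else_; _xor_; _∧_; _∨_; not)
open import Data.Nat as ℕ using (ℕ; zero; suc; _≤_; _<_)
open import Data.Nat.Divisibility using (_∣?_)
open import Data.Nat.Primality using (prime?)
open import Data.Integer as ℤ using (ℤ; +_; -[1+_])
open import Data.List using (List; []; _∷_; map; upTo; filterᵇ; length; foldr)
open import Data.List.Relation.Unary.All using (All)
open import Data.List.Relation.Unary.Any using (Any)
open import Data.List.Relation.Unary.AllPairs using (AllPairs)
open import Data.Product using (Σ; ∃; _×_; _,_)
open import Data.Sum using (_⊎_)
open import Relation.Nullary using (¬_; does)
open import Relation.Binary.PropositionalEquality using (_≡_)

-- 2-adic integers as bit streams: f i is the i-th binary digit of f.
-- Equality of 2-adic integers is pointwise equality of digits.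

ℤ₂ : Set
ℤ₂ = ℕ → Bool

infix 4 _≈₂_
_≈₂_ : ℤ₂ → ℤ₂ → Set
f ≈₂ g = ∀ i → f i ≡ g i

-- majority function (carry of a full adder)
maj : Bool → Bool → Bool → Bool
maj a b c = (a ∧ b) ∨ (c ∧ (a xor b))

carry : ℤ₂ → ℤ₂ → Bool → ℕ → Bool
carry f g c zero    = c
carry f g c (suc i) = maj (f i) (g i) (carry f g c i)

addc : ℤ₂ → ℤ₂ → Bool → ℤ₂
addc f g c i = (f i xor g i) xor carry f g c i

twice : ℤ₂ → ℤ₂
twice f zero    = false
twice f (suc i) = f i

-- f / 2 (meaningful when f is even)
half : ℤ₂ → ℤ₂
half f i = f (suc i)

-- 3 f + 1 = f + 2f + 1
threeXPlusOne : ℤ₂ → ℤ₂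
threeXPlusOne f = addc f (twice f) true

collatz : ℤ₂ → ℤ₂
collatz f = if f 0 then threeXPlusOne f else half f

iter : ℕ → ℤ₂ → ℤ₂
iter zero    f = f
iter (suc k) f = collatz (iter k f)

HasPeriod : ℕ → ℤ₂ → Set
HasPeriod n f = 1 ≤ n × iter n f ≈₂ f × (∀ k → 1 ≤ k → k < n → ¬ (iter k f ≈₂ f))

InOrbit : ℤ₂ → ℤ₂ → Set
InOrbit f g = ∃ λ k → iter k f ≈₂ g

-- Then the number of T-cycles of length n is finite and equals length L.
CyclesOfLength : ℕ → List ℤ₂ → Set
CyclesOfLength n L =
  All (HasPeriod n) L ×
  AllPairs (λ f g → ¬ InOrbit f g) L ×
  (∀ f → HasPeriod n f → Any (λ g → InOrbit g f) L)

primeDivisors : ℕ → List ℕ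
primeDivisors d = filterᵇ (λ p → does (prime? p) ∧ does (p ∣? d)) (upTo (suc d))

squarefreeᵇ : ℕ → Bool
squarefreeᵇ d = foldr (λ p b → not (does ((p ℕ.* p) ∣? d)) ∧ b) true (primeDivisors d)

μ : ℕ → ℤ
μ zero = + 0
μ d@(suc _) = if squarefreeᵇ d then -[1+ 0 ] ℤ.^ length (primeDivisors d) else + 0

-- The ring ℤ[φ] = { a + b φ }, φ = (1+√5)/2, φ² = φ + 1, represented by (a , b).

record ℤφ : Set where
  constructor _+_φ
  field
    re : ℤ
    im : ℤ
open ℤφ public

infixl 6 _⊕_ _⊖_
infixl 7 _⊗_

_⊕_ : ℤφ → ℤφ → ℤφ
(a + b φ) ⊕ (c + d φ) = (a ℤ.+ c) + (b ℤ.+ d) φ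

_⊖_ : ℤφ → ℤφ → ℤφ
(a + b φ) ⊖ (c + d φ) = (a ℤ.- c) + (b ℤ.- d) φ

_⊗_ : ℤφ → ℤφ → ℤφ
(a + b φ) ⊗ (c + d φ) = (a ℤ.* c ℤ.+ b ℤ.* d) + (a ℤ.* d ℤ.+ b ℤ.* c ℤ.+ b ℤ.* d) φ

embed : ℤ → ℤφ
embed a = a + (+ 0) φ

0φ 1φ φ ψ : ℤφ
0φ = embed (+ 0)
1φ = embed (+ 1)
φ = (+ 0) + (+ 1) φ
ψ = 1φ ⊖ φ          -- ψ = (1 - √5)/2 = 1 - φ

_^φ_ : ℤφ → ℕ → ℤφ
x ^φ zero  = 1φ
x ^φ suc k = x ⊗ (x ^φ k)

mobiusSum : ℕ → ℤφ
mobiusSum n =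
  foldr _⊕_ 0φ
    (map (λ k → embed (μ (suc k)) ⊗ ((φ ^φ (n ℕ./ suc k)) ⊕ (ψ ^φ (n ℕ./ suc k))))
      (filterᵇ (λ k → does (suc k ∣? n)) (upTo n)))
  -- k ranges over 0 … n-1, i.e. d = suc k ranges over the divisors 1 … n of n

-- Order on the real numbers a + bφ.  With x = 2a + b, y = b we have
-- a + bφ = (x + y√5)/2, which is > 0 iff one of the cases below holds.

data Positive : ℤφ → Set where
  pos₁ : ∀ {a b} → ℤ.0ℤ ℤ.< (+ 2) ℤ.* a ℤ.+ b → ℤ.0ℤ ℤ.≤ b → Positive (a + b φ)
  pos₂ : ∀ {a b} → ℤ.0ℤ ℤ.≤ (+ 2) ℤ.* a ℤ.+ b → ℤ.0ℤ ℤ.< b → Positive (a + b φ)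
  pos₃ : ∀ {a b} → ℤ.0ℤ ℤ.< (+ 2) ℤ.* a ℤ.+ b → b ℤ.< ℤ.0ℤ →
         (+ 5) ℤ.* (b ℤ.* b) ℤ.< ((+ 2) ℤ.* a ℤ.+ b) ℤ.* ((+ 2) ℤ.* a ℤ.+ b) →
         Positive (a + b φ)
  pos₄ : ∀ {a b} → (+ 2) ℤ.* a ℤ.+ b ℤ.< ℤ.0ℤ → ℤ.0ℤ ℤ.< b →
         ((+ 2) ℤ.* a ℤ.+ b) ℤ.* ((+ 2) ℤ.* a ℤ.+ b) ℤ.< (+ 5) ℤ.* (b ℤ.* b) →
         Positive (a + b φ)

infix 4 _<φ_
_<φ_ : ℤφ → ℤφ → Set
x <φ y = Positive (y ⊖ x)

AbsLt : ℤφ → ℤφ → Set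
AbsLt x y = x <φ y × (0φ ⊖ x) <φ y

-- Z n ∼ φ^n / n, i.e. n·Z n / φ^n → 1:
-- for every rational ε = p/q > 0 there is N with
-- q·|n·Z n − φ^n| < p·φ^n for all n ≥ N.
AsymptoticPhiOverN : (ℕ → ℕ) → Set
AsymptoticPhiOverN Z =
  ∀ (p q : ℕ) → 1 ≤ p → 1 ≤ q →
  ∃ λ N → ∀ n → N ≤ n →
    AbsLt (embed (+ q) ⊗ (embed (+ (n ℕ.* Z n)) ⊖ (φ ^φ n)))
          (embed (+ p) ⊗ (φ ^φ n))

module Submission where

-- The parity vector f ↦ (T^i f mod 2)_i is a bijection from ℤ₂ onto the admissible 0/1-sequences
-- (no two consecutive 1s, as 3f + 1 is even for odd f) which turns T into the shift. So T-cycles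
-- of length n are the rotation classes of admissible cyclic words of exact period n, and n Z_n is
-- the number E_n of such words. Sorting all admissible cyclic words of length n by exact period
-- gives Σ_{d ∣ n} E_d = L_n, the Lucas number φ^n + ψ^n, and Möbius inversion gives the formula.
-- For the asymptotics, n Z_n = L_n − Σ_{d ∣ n, d < n} E_d where the error is at most L_{n/2 + 2};
-- comparisons in ℤ[φ] reduce, via Cassini's identity L_n² − 5 F_n² = ±4, to inequalities in ℕ.

module ParityVector where

  open import Defs
  open import Data.Bool using (Bool; true; false; if_then_else_; _xor_; not)
  open import Data.Bool.Properties using (not-¬)
  open import Data.Empty using (⊥-elim)
  open import Data.Nat using (ℕ; zero; suc; _+_; _≤_; z≤n; s≤s)
  open import Data.Nat.Properties using (m≤n⇒m<n∨m≡n; ≤-refl; ≤-trans; m≤n⇒m≤1+n; +-comm; n≤1+n; m≤n+m; m≤n⇒∃[o]m+o≡n)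
  open import Data.Product using (_×_; _,_; proj₁; proj₂)
  open import Data.Sum using (inj₁; inj₂)
  open import Relation.Binary.PropositionalEquality using (_≡_; refl; sym; trans; cong; cong₂; subst; module ≡-Reasoning)

  AgreeUpTo : ℕ → ℤ₂ → ℤ₂ → Set
  AgreeUpTo m f g = ∀ i → i ≤ m → f i ≡ g i

  agree-down : ∀ {m f g} → AgreeUpTo (suc m) f g → AgreeUpTo m f g
  agree-down p i q = p i (m≤n⇒m≤1+n q)

  agree-ext : ∀ {m f g} → AgreeUpTo m f g → f (suc m) ≡ g (suc m) → AgreeUpTo (suc m) f g
  agree-ext {m} p e i q with m≤n⇒m<n∨m≡n q
  ... | inj₁ (s≤s r) = p i r
  ... | inj₂ refl = e

  agree-shift : ∀ {m f g} → f 0 ≡ g 0 → AgreeUpTo m (half f) (half g) → AgreeUpTo (suc m) f g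
  agree-shift e p zero q = e
  agree-shift e p (suc i) (s≤s q) = p i q

  agree-half : ∀ {m f g} → AgreeUpTo (suc m) f g → AgreeUpTo m (half f) (half g)
  agree-half p i q = p (suc i) (s≤s q)

  agree-all : ∀ {f g} → f ≈₂ g → ∀ m → AgreeUpTo m f g
  agree-all e m i _ = e i

  carry-agree : ∀ {k f f' g g'} c → AgreeUpTo k f f' → AgreeUpTo k g g' →
                ∀ i → i ≤ suc k → carry f g c i ≡ carry f' g' c i
  carry-agree c p q zero _ = refl
  carry-agree {f' = f'} {g' = g'} c p q (suc i) (s≤s r) =
    trans (cong₂ (λ x y → maj x y _) (p i r) (q i r))
          (cong (maj (f' i) (g' i)) (carry-agree c p q i (m≤n⇒m≤1+n r)))

  addc-agree : ∀ {k f f' g g'} c → AgreeUpTo k f f' → AgreeUpTo k g g' →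
               AgreeUpTo k (addc f g c) (addc f' g' c)
  addc-agree c p q i r = cong₂ _xor_ (cong₂ _xor_ (p i r) (q i r)) (carry-agree c p q i (m≤n⇒m≤1+n r))

  twice-agree : ∀ {k f g} → AgreeUpTo k f g → AgreeUpTo (suc k) (twice f) (twice g)
  twice-agree p zero _ = refl
  twice-agree p (suc i) (s≤s r) = p i r

  threeXPlusOne-agree : ∀ {k f g} → AgreeUpTo k f g → AgreeUpTo k (threeXPlusOne f) (threeXPlusOne g)
  threeXPlusOne-agree p = addc-agree true p (agree-down (twice-agree p))

  collatz-agree : ∀ {m} f g → AgreeUpTo (suc m) f g → AgreeUpTo m (collatz f) (collatz g)
  collatz-agree f g p with f 0 | g 0 | p 0 z≤n
  ... | true  | true  | refl = agree-down (threeXPlusOne-agree p)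
  ... | false | false | refl = agree-half p

  collatz-even : ∀ f → f 0 ≡ false → collatz f ≡ half f
  collatz-even f e rewrite e = refl

  collatz-odd : ∀ f → f 0 ≡ true → collatz f ≡ threeXPlusOne f
  collatz-odd f e rewrite e = refl

  threeXPlusOne-even : ∀ f → f 0 ≡ true → threeXPlusOne f 0 ≡ false
  threeXPlusOne-even f e rewrite e = refl

  parity : ℤ₂ → ℕ → Bool
  parity f i = iter i f 0

  iter-collatz : ∀ k f → iter k (collatz f) ≡ collatz (iter k f)
  iter-collatz zero f = refl
  iter-collatz (suc k) f = cong collatz (iter-collatz k f)

  parity-collatz : ∀ f i → parity (collatz f) i ≡ parity f (suc i)
  parity-collatz f i = cong (λ h → h 0) (iter-collatz i f)

  parity-agree : ∀ j f g → AgreeUpTo j f g → parity f j ≡ parity g j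
  parity-agree zero f g p = p 0 z≤n
  parity-agree (suc j) f g p = begin
    parity f (suc j)         ≡⟨ sym (parity-collatz f j) ⟩
    parity (collatz f) j     ≡⟨ parity-agree j _ _ (collatz-agree f g p) ⟩
    parity (collatz g) j     ≡⟨ parity-collatz g j ⟩
    parity g (suc j)         ∎
    where open ≡-Reasoning

  parity-cong : ∀ {f g} → f ≈₂ g → ∀ j → parity f j ≡ parity g j
  parity-cong e j = parity-agree j _ _ (agree-all e j)

  Admissible : ℤ₂ → Set
  Admissible w = ∀ i → w i ≡ true → w (suc i) ≡ false

  parity-admissible : ∀ f → Admissible (parity f)
  parity-admissible f i e =
    trans (cong (λ h → h 0) (collatz-odd (iter i f) e)) (threeXPlusOne-even (iter i f) e)

  xor-cancelʳ : ∀ a a' b → a xor b ≡ a' xor b → a ≡ a'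
  xor-cancelʳ true  true  b e = refl
  xor-cancelʳ false false b e = refl
  xor-cancelʳ true  false b e = ⊥-elim (not-¬ refl (sym e))
  xor-cancelʳ false true  b e = ⊥-elim (not-¬ refl e)

  threeXPlusOne-cancel-upTo : ∀ j f g → AgreeUpTo j (threeXPlusOne f) (threeXPlusOne g) →
    AgreeUpTo j f g × carry f (twice f) true (suc j) ≡ carry g (twice g) true (suc j)
  threeXPlusOne-cancel-upTo zero f g p = (λ { zero z≤n → f₀≡g₀ }) , cong (λ x → maj x false true) f₀≡g₀
    where
    f₀≡g₀ : f 0 ≡ g 0
    f₀≡g₀ = xor-cancelʳ _ _ _ (xor-cancelʳ _ _ _ (p 0 z≤n))
  threeXPlusOne-cancel-upTo (suc j) f g p with threeXPlusOne-cancel-upTo j f g (agree-down p)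
  ... | agree , carry≡ =
    agree-ext agree next≡ ,
    trans (cong₂ (λ x y → maj x y _) next≡ (agree j ≤-refl)) (cong (maj (g (suc j)) (g j)) carry≡)
    where
    next≡ : f (suc j) ≡ g (suc j)
    next≡ = xor-cancelʳ _ _ _ (xor-cancelʳ _ _ _
      (trans (p (suc j) ≤-refl) (cong₂ (λ x y → (g (suc j) xor x) xor y) (sym (agree j ≤-refl)) (sym carry≡))))

  threeXPlusOne-cancel : ∀ j f g → AgreeUpTo j (threeXPlusOne f) (threeXPlusOne g) → AgreeUpTo j f g
  threeXPlusOne-cancel j f g p = proj₁ (threeXPlusOne-cancel-upTo j f g p)

  parity-half : ∀ f → f 0 ≡ false → ∀ i → parity (half f) i ≡ parity f (suc i)
  parity-half f e i = trans (cong (λ h → parity h i) (sym (collatz-even f e))) (parity-collatz f i)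

  parity-half-threeXPlusOne : ∀ f → f 0 ≡ true → ∀ i → parity (half (threeXPlusOne f)) i ≡ parity f (suc (suc i))
  parity-half-threeXPlusOne f e i = begin
    parity (half (threeXPlusOne f)) i ≡⟨ parity-half (threeXPlusOne f) (threeXPlusOne-even f e) i ⟩
    parity (threeXPlusOne f) (suc i) ≡⟨ cong (λ h → parity h (suc i)) (sym (collatz-odd f e)) ⟩
    parity (collatz f) (suc i)       ≡⟨ parity-collatz f (suc i) ⟩
    parity f (suc (suc i))           ∎
    where open ≡-Reasoning

  parity-injective-upTo : ∀ j f g → (∀ i → parity f i ≡ parity g i) → AgreeUpTo j f g
  parity-injective-upTo zero f g e zero z≤n = e 0
  parity-injective-upTo (suc j) f g e with f 0 in ef | g 0 in eg
  ... | false | false = agree-shift (trans ef (sym eg)) (parity-injective-upTo j (half f) (half g)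
        λ i → trans (parity-half f ef i) (trans (e (suc i)) (sym (parity-half g eg i))))
  ... | true | true = threeXPlusOne-cancel (suc j) f g
        (agree-shift (trans (threeXPlusOne-even f ef) (sym (threeXPlusOne-even g eg)))
          (parity-injective-upTo j (half (threeXPlusOne f)) (half (threeXPlusOne g))
            λ i → trans (parity-half-threeXPlusOne f ef i)
                    (trans (e (suc (suc i))) (sym (parity-half-threeXPlusOne g eg i)))))
  ... | false | true with () ← trans (sym ef) (trans (e 0) eg)
  ... | true | false with () ← trans (sym ef) (trans (e 0) eg)

  parity-injective : ∀ f g → (∀ i → parity f i ≡ parity g i) → f ≈₂ g
  parity-injective f g e i = parity-injective-upTo i f g e i ≤-refl

  -- (g − 1)/3 for even g by long division from the lowest digit: the state holds the previous
  -- digit of the quotient f and the carry of f + 2f + 1 into the current digit.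
  divisionStep : Bool → Bool × Bool → Bool × Bool
  divisionStep gᵢ (f₋ , c) = ((gᵢ xor f₋) xor c) , maj ((gᵢ xor f₋) xor c) f₋ c

  divisionState : ℤ₂ → ℕ → Bool × Bool
  divisionState g zero = not (g 0) , not (g 0)
  divisionState g (suc i) = divisionStep (g (suc i)) (divisionState g i)

  threeXPlusOne⁻¹ : ℤ₂ → ℤ₂
  threeXPlusOne⁻¹ g i = proj₁ (divisionState g i)

  threeXPlusOne⁻¹-carry : ∀ g i → carry (threeXPlusOne⁻¹ g) (twice (threeXPlusOne⁻¹ g)) true (suc i) ≡ proj₂ (divisionState g i)
  threeXPlusOne⁻¹-carry g zero with g 0
  ... | true = refl
  ... | false = refl
  threeXPlusOne⁻¹-carry g (suc i) rewrite threeXPlusOne⁻¹-carry g i with divisionState g i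
  ... | _ , _ = refl

  xor-xor-cancel : ∀ x y c → (((x xor y) xor c) xor y) xor c ≡ x
  xor-xor-cancel true  true  true  = refl
  xor-xor-cancel true  true  false = refl
  xor-xor-cancel true  false true  = refl
  xor-xor-cancel true  false false = refl
  xor-xor-cancel false true  true  = refl
  xor-xor-cancel false true  false = refl
  xor-xor-cancel false false true  = refl
  xor-xor-cancel false false false = refl

  threeXPlusOne-threeXPlusOne⁻¹ : ∀ g → g 0 ≡ false → threeXPlusOne (threeXPlusOne⁻¹ g) ≈₂ g
  threeXPlusOne-threeXPlusOne⁻¹ g e zero rewrite e = refl
  threeXPlusOne-threeXPlusOne⁻¹ g e (suc i) rewrite threeXPlusOne⁻¹-carry g i with divisionState g i
  ... | f₋ , c = xor-xor-cancel (g (suc i)) f₋ c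

  divisionState-agree : ∀ {k g g'} → AgreeUpTo k g g' → ∀ i → i ≤ k → divisionState g i ≡ divisionState g' i
  divisionState-agree p zero q = cong (λ x → not x , not x) (p 0 z≤n)
  divisionState-agree p (suc i) q = cong₂ divisionStep (p (suc i) q) (divisionState-agree p i (≤-trans (n≤1+n i) q))

  threeXPlusOne⁻¹-agree : ∀ {k g g'} → AgreeUpTo k g g' → AgreeUpTo k (threeXPlusOne⁻¹ g) (threeXPlusOne⁻¹ g')
  threeXPlusOne⁻¹-agree p i q = cong proj₁ (divisionState-agree p i q)

  -- An element whose first m+1 parities are those of w (when w is admissible), built by
  -- running the Collatz map backwards.
  approxFromParity : ℕ → ℤ₂ → ℤ₂
  approxFromParity zero w = λ _ → w 0
  approxFromParity (suc m) w =
    if w 0 then threeXPlusOne⁻¹ (twice (approxFromParity m (half (half w))))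
           else twice (approxFromParity m (half w))

  approxFromParity-stable : ∀ m w → AgreeUpTo m (approxFromParity m w) (approxFromParity (suc m) w)
  approxFromParity-stable zero w zero z≤n with w 0
  ... | true = refl
  ... | false = refl
  approxFromParity-stable (suc m) w with w 0
  ... | true = threeXPlusOne⁻¹-agree (twice-agree (approxFromParity-stable m (half (half w))))
  ... | false = twice-agree (approxFromParity-stable m (half w))

  approxFromParity-stable-+ : ∀ k m w → AgreeUpTo m (approxFromParity m w) (approxFromParity (k + m) w)
  approxFromParity-stable-+ zero m w i q = refl
  approxFromParity-stable-+ (suc k) m w i q =
    trans (approxFromParity-stable-+ k m w i q) (approxFromParity-stable (k + m) w i (≤-trans q (m≤n+m m k)))

  -- The approximations stabilise digitwise, so their diagonal is the 2-adic limit.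
  fromParity : ℤ₂ → ℤ₂
  fromParity w i = approxFromParity i w i

  fromParity-agree : ∀ m w → AgreeUpTo m (fromParity w) (approxFromParity m w)
  fromParity-agree m w i q with m≤n⇒∃[o]m+o≡n q
  ... | k , refl = subst (λ t → approxFromParity i w i ≡ approxFromParity t w i) (+-comm k i)
                         (approxFromParity-stable-+ k i w i ≤-refl)

  parity-approxFromParity : ∀ m w → Admissible w → ∀ j → j ≤ m → parity (approxFromParity m w) j ≡ w j
  parity-approxFromParity zero w a zero z≤n = refl
  parity-approxFromParity (suc m) w a zero q with w 0
  ... | true = refl
  ... | false = refl
  parity-approxFromParity (suc m) w a (suc j) (s≤s q) with w 0 in e
  ... | false = trans (sym (parity-collatz (twice (approxFromParity m (half w))) j))
                      (parity-approxFromParity m (half w) (λ i → a (suc i)) j q)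
  ... | true = trans (sym (parity-collatz (threeXPlusOne⁻¹ g) j))
                     (trans (parity-cong (threeXPlusOne-threeXPlusOne⁻¹ g refl) j) (parity-twice j q))
    where
    g = twice (approxFromParity m (half (half w)))
    parity-twice : ∀ j → j ≤ m → parity g j ≡ w (suc j)
    parity-twice zero _ = sym (a 0 e)
    parity-twice (suc j) q = trans (sym (parity-collatz g j))
      (parity-approxFromParity m (half (half w)) (λ i → a (suc (suc i))) j (≤-trans (n≤1+n j) q))

  parity-fromParity : ∀ w → Admissible w → ∀ j → parity (fromParity w) j ≡ w j
  parity-fromParity w a j = trans (parity-agree j _ _ (fromParity-agree j w)) (parity-approxFromParity j w a j ≤-refl)


module CycleCorrespondence where

  open import Defs
  open ParityVector
  open import Data.Nat using (ℕ; zero; suc; _+_; _≤_; _<_)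
  open import Data.Nat.Properties using (+-comm)
  open import Data.Product using (_×_; _,_; proj₁; proj₂; ∃)
  open import Data.List using (List; []; _∷_; map)
  open import Data.List.Relation.Unary.All using (All; []; _∷_)
  open import Data.List.Relation.Unary.Any using (Any; here; there)
  open import Data.List.Relation.Unary.AllPairs using (AllPairs; []; _∷_)
  open import Relation.Nullary using (¬_)
  open import Relation.Binary.PropositionalEquality using (_≡_; refl; sym; trans; cong)

  shift : ℕ → ℤ₂ → ℤ₂
  shift k w i = w (k + i)

  Periodic : ∀ {A : Set} → ℕ → (ℕ → A) → Set
  Periodic n w = ∀ i → w (n + i) ≡ w i

  ExactPeriod : ℕ → ℤ₂ → Set
  ExactPeriod n w = Admissible w × Periodic n w × (∀ k → 1 ≤ k → k < n → ¬ Periodic k w)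

  ShiftRelated : ℤ₂ → ℤ₂ → Set
  ShiftRelated w w' = ∃ λ k → shift k w ≈₂ w'

  record ShiftClassReps (n : ℕ) : Set where
    field
      reps : List ℤ₂
      allExact : All (ExactPeriod n) reps
      distinct : AllPairs (λ w w' → ¬ ShiftRelated w w') reps
      complete : ∀ w → ExactPeriod n w → Any (λ r → ShiftRelated r w) reps

  iter-+ : ∀ i k f → iter i (iter k f) ≡ iter (i + k) f
  iter-+ zero k f = refl
  iter-+ (suc i) k f = cong collatz (iter-+ i k f)

  parity-iter : ∀ k f i → parity (iter k f) i ≡ parity f (k + i)
  parity-iter k f i = trans (cong (λ h → h 0) (iter-+ i k f)) (cong (parity f) (+-comm i k))

  iter⇒shift-parity : ∀ k f g → iter k f ≈₂ g → ∀ i → parity f (k + i) ≡ parity g i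
  iter⇒shift-parity k f g e i = trans (sym (parity-iter k f i)) (parity-cong e i)

  shift-parity⇒iter : ∀ k f g → (∀ i → parity f (k + i) ≡ parity g i) → iter k f ≈₂ g
  shift-parity⇒iter k f g e = parity-injective (iter k f) g (λ i → trans (parity-iter k f i) (e i))

  fromParity-shift : ∀ {r r'} → Admissible r → Admissible r' →
                     InOrbit (fromParity r) (fromParity r') → ShiftRelated r r'
  fromParity-shift a a' (k , e) = k , λ i →
    trans (sym (parity-fromParity _ a (k + i))) (trans (iter⇒shift-parity k _ _ e i) (parity-fromParity _ a' i))

  fromParity-hasPeriod : ∀ n → 1 ≤ n → ∀ r → ExactPeriod n r → HasPeriod n (fromParity r)
  fromParity-hasPeriod n n≥1 r (a , p , m) =
    n≥1 ,
    shift-parity⇒iter n _ _ (λ i → trans (parity-fromParity r a (n + i)) (trans (p i) (sym (parity-fromParity r a i)))) ,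
    λ k k≥1 k<n e → m k k≥1 k<n (proj₂ (fromParity-shift a a (k , e)))

  parity-exactPeriod : ∀ n f → HasPeriod n f → ExactPeriod n (parity f)
  parity-exactPeriod n f (_ , e , m) =
    parity-admissible f , iter⇒shift-parity n f f e , λ k k≥1 k<n p → m k k≥1 k<n (shift-parity⇒iter k f f p)

  module FromShiftClassReps {n : ℕ} (n≥1 : 1 ≤ n) (C : ShiftClassReps n) where
    open ShiftClassReps C

    allHasPeriod : ∀ rs → All (ExactPeriod n) rs → All (HasPeriod n) (map fromParity rs)
    allHasPeriod [] [] = []
    allHasPeriod (r ∷ rs) (x ∷ xs) = fromParity-hasPeriod n n≥1 r x ∷ allHasPeriod rs xs

    differentOrbits : ∀ {r} rs → ExactPeriod n r → All (λ r' → ¬ ShiftRelated r r') rs → All (ExactPeriod n) rs →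
                      All (λ g → ¬ InOrbit (fromParity r) g) (map fromParity rs)
    differentOrbits [] _ [] [] = []
    differentOrbits (r' ∷ rs) x (y ∷ ys) (z ∷ zs) =
      (λ o → y (fromParity-shift (proj₁ x) (proj₁ z) o)) ∷ differentOrbits rs x ys zs

    pairwiseDifferentOrbits : ∀ rs → All (ExactPeriod n) rs → AllPairs (λ w w' → ¬ ShiftRelated w w') rs →
                              AllPairs (λ f g → ¬ InOrbit f g) (map fromParity rs)
    pairwiseDifferentOrbits [] [] [] = []
    pairwiseDifferentOrbits (r ∷ rs) (x ∷ xs) (y ∷ ys) = differentOrbits rs x y xs ∷ pairwiseDifferentOrbits rs xs ys

    meetsOrbit : ∀ rs → All (ExactPeriod n) rs → ∀ f → Any (λ r → ShiftRelated r (parity f)) rs →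
                 Any (λ g → InOrbit g f) (map fromParity rs)
    meetsOrbit (r ∷ rs) ((a , _) ∷ xs) f (here (k , e)) =
      here (k , shift-parity⇒iter k (fromParity r) f (λ i → trans (parity-fromParity r a (k + i)) (e i)))
    meetsOrbit (r ∷ rs) (x ∷ xs) f (there y) = there (meetsOrbit rs xs f y)

    cycles : CyclesOfLength n (map fromParity reps)
    cycles = allHasPeriod reps allExact ,
             pairwiseDifferentOrbits reps allExact distinct ,
             λ f hp → meetsOrbit reps allExact f (complete (parity f) (parity-exactPeriod n f hp))


module FiniteSums where

  open import Data.Nat as ℕ using (ℕ; zero; suc; _≤_; _<_)
  import Data.Nat.Properties as ℕP
  open import Data.Integer as ℤ using (ℤ)
  import Data.Integer.Properties as ℤP
  open import Data.List using (List; []; _∷_; _++_; map)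
  open import Data.List.Membership.Propositional using (_∈_)
  open import Data.List.Relation.Unary.Any using (here; there)
  open import Data.Product using (_,_)
  open import Relation.Nullary using (yes; no)
  open import Relation.Binary.PropositionalEquality using (_≡_; _≢_; refl; sym; trans; cong; cong₂; module ≡-Reasoning)
  open ≡-Reasoning

  module RangeSums {A : Set} (_+_ _*_ : A → A → A) (0# : A)
    (+-assoc : ∀ x y z → (x + y) + z ≡ x + (y + z))
    (+-comm : ∀ x y → x + y ≡ y + x)
    (+-identityˡ : ∀ x → 0# + x ≡ x)
    (*-distribˡ-+ : ∀ x y z → x * (y + z) ≡ (x * y) + (x * z))
    (*-zeroʳ : ∀ x → x * 0# ≡ 0#) where

    +-identityʳ : ∀ x → x + 0# ≡ x
    +-identityʳ x = trans (+-comm x 0#) (+-identityˡ x)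

    +-interchange : ∀ a b c d → (a + b) + (c + d) ≡ (a + c) + (b + d)
    +-interchange a b c d = begin
      (a + b) + (c + d) ≡⟨ +-assoc a b (c + d) ⟩
      a + (b + (c + d)) ≡⟨ cong (a +_) (sym (+-assoc b c d)) ⟩
      a + ((b + c) + d) ≡⟨ cong (λ t → a + (t + d)) (+-comm b c) ⟩
      a + ((c + b) + d) ≡⟨ cong (a +_) (+-assoc c b d) ⟩
      a + (c + (b + d)) ≡⟨ sym (+-assoc a c (b + d)) ⟩
      (a + c) + (b + d) ∎

    sum< : ℕ → (ℕ → A) → A
    sum< zero f = 0#
    sum< (suc n) f = sum< n f + f n

    sum<-cong : ∀ n {f g} → (∀ k → k < n → f k ≡ g k) → sum< n f ≡ sum< n g
    sum<-cong zero e = refl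
    sum<-cong (suc n) e = cong₂ _+_ (sum<-cong n (λ k k<n → e k (ℕP.m<n⇒m<1+n k<n))) (e n ℕP.≤-refl)

    sum<-+ : ∀ n f g → sum< n (λ k → f k + g k) ≡ sum< n f + sum< n g
    sum<-+ zero f g = sym (+-identityˡ 0#)
    sum<-+ (suc n) f g = trans (cong (_+ (f n + g n)) (sum<-+ n f g)) (+-interchange _ _ _ _)

    sum<-*ˡ : ∀ n c f → sum< n (λ k → c * f k) ≡ c * sum< n f
    sum<-*ˡ zero c f = sym (*-zeroʳ c)
    sum<-*ˡ (suc n) c f = trans (cong (_+ (c * f n)) (sum<-*ˡ n c f)) (sym (*-distribˡ-+ c _ _))

    sum<-zero : ∀ n {f} → (∀ k → k < n → f k ≡ 0#) → sum< n f ≡ 0#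
    sum<-zero n e = trans (sum<-cong n e) (sum<-0# n)
      where
      sum<-0# : ∀ n → sum< n (λ _ → 0#) ≡ 0#
      sum<-0# zero = refl
      sum<-0# (suc n) = trans (+-identityʳ _) (sum<-0# n)

    sum<-swap : ∀ n m (f : ℕ → ℕ → A) → sum< n (λ i → sum< m (f i)) ≡ sum< m (λ j → sum< n (λ i → f i j))
    sum<-swap zero m f = sym (sum<-zero m (λ _ _ → refl))
    sum<-swap (suc n) m f = begin
      sum< n (λ i → sum< m (f i)) + sum< m (f n)     ≡⟨ cong (_+ sum< m (f n)) (sum<-swap n m f) ⟩
      sum< m (λ j → sum< n (λ i → f i j)) + sum< m (f n) ≡⟨ sym (sum<-+ m (λ j → sum< n (λ i → f i j)) (f n)) ⟩
      sum< m (λ j → sum< n (λ i → f i j) + f n j)    ∎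

    sum<-split : ∀ n m f → sum< (n ℕ.+ m) f ≡ sum< n f + sum< m (λ k → f (n ℕ.+ k))
    sum<-split n zero f = trans (cong (λ t → sum< t f) (ℕP.+-identityʳ n)) (sym (+-identityʳ _))
    sum<-split n (suc m) f = begin
      sum< (n ℕ.+ suc m) f                              ≡⟨ cong (λ t → sum< t f) (ℕP.+-suc n m) ⟩
      sum< (n ℕ.+ m) f + f (n ℕ.+ m)                    ≡⟨ cong (_+ f (n ℕ.+ m)) (sum<-split n m f) ⟩
      (sum< n f + sum< m (λ k → f (n ℕ.+ k))) + f (n ℕ.+ m) ≡⟨ +-assoc _ _ _ ⟩
      sum< n f + (sum< m (λ k → f (n ℕ.+ k)) + f (n ℕ.+ m)) ∎

    sum<-shrink : ∀ n N {f} → n ≤ N → (∀ k → n ≤ k → k < N → f k ≡ 0#) → sum< N f ≡ sum< n f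
    sum<-shrink n N {f} n≤N e with ℕP.m≤n⇒∃[o]m+o≡n n≤N
    ... | o , refl = trans (sum<-split n o f) (trans (cong (sum< n f +_) tail≡0) (+-identityʳ _))
      where
      tail≡0 : sum< o (λ k → f (n ℕ.+ k)) ≡ 0#
      tail≡0 = sum<-zero o (λ k k<o → e (n ℕ.+ k) (ℕP.m≤m+n n k) (ℕP.+-monoʳ-< n k<o))

    sum<-single : ∀ n j {f} → j < n → (∀ k → k < n → k ≢ j → f k ≡ 0#) → sum< n f ≡ f j
    sum<-single (suc n) j {f} j<n e with j ℕ.≟ n
    ... | yes refl = trans (cong (_+ f j) (sum<-zero n (λ k k<n → e k (ℕP.m<n⇒m<1+n k<n) (ℕP.<⇒≢ k<n))))
                           (+-identityˡ _)
    ... | no j≢n = trans (cong₂ _+_ (sum<-single n j (ℕP.≤∧≢⇒< (ℕP.≤-pred j<n) j≢n) (λ k k<n → e k (ℕP.m<n⇒m<1+n k<n)))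
                                    (e n ℕP.≤-refl (λ n≡j → j≢n (sym n≡j))))
                         (+-identityʳ _)

    sum<-suc : ∀ K g → sum< (suc K) g ≡ g 0 + sum< K (λ q → g (suc q))
    sum<-suc zero g = +-comm 0# (g 0)
    sum<-suc (suc K) g = trans (cong (_+ g (suc K)) (sum<-suc K g)) (+-assoc (g 0) _ _)

    sumL : ∀ {B : Set} → List B → (B → A) → A
    sumL [] f = 0#
    sumL (x ∷ xs) f = f x + sumL xs f

    sumL-cong : ∀ {B : Set} (xs : List B) {f g} → (∀ x → x ∈ xs → f x ≡ g x) → sumL xs f ≡ sumL xs g
    sumL-cong [] e = refl
    sumL-cong (x ∷ xs) e = cong₂ _+_ (e x (here refl)) (sumL-cong xs (λ y y∈ → e y (there y∈)))

    sumL-+ : ∀ {B : Set} (xs : List B) f g → sumL xs (λ k → f k + g k) ≡ sumL xs f + sumL xs g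
    sumL-+ [] f g = sym (+-identityˡ 0#)
    sumL-+ (x ∷ xs) f g = trans (cong ((f x + g x) +_) (sumL-+ xs f g)) (+-interchange _ _ _ _)

    sumL-*ˡ : ∀ {B : Set} (xs : List B) c f → sumL xs (λ k → c * f k) ≡ c * sumL xs f
    sumL-*ˡ [] c f = sym (*-zeroʳ c)
    sumL-*ˡ (x ∷ xs) c f = trans (cong ((c * f x) +_) (sumL-*ˡ xs c f)) (sym (*-distribˡ-+ c _ _))

    sumL-zero : ∀ {B : Set} (xs : List B) {f} → (∀ x → x ∈ xs → f x ≡ 0#) → sumL xs f ≡ 0#
    sumL-zero [] e = refl
    sumL-zero (x ∷ xs) e = trans (cong₂ _+_ (e x (here refl)) (sumL-zero xs (λ y y∈ → e y (there y∈)))) (+-identityˡ 0#)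

    sumL-++ : ∀ {B : Set} (xs ys : List B) f → sumL (xs ++ ys) f ≡ sumL xs f + sumL ys f
    sumL-++ [] ys f = sym (+-identityˡ _)
    sumL-++ (x ∷ xs) ys f = trans (cong (f x +_) (sumL-++ xs ys f)) (sym (+-assoc _ _ _))

    sumL-map : ∀ {B C : Set} (g : B → C) (xs : List B) f → sumL (map g xs) f ≡ sumL xs (λ x → f (g x))
    sumL-map g [] f = refl
    sumL-map g (x ∷ xs) f = cong (f (g x) +_) (sumL-map g xs f)

    sumL-sum< : ∀ {B : Set} (xs : List B) n (f : B → ℕ → A) →
                sumL xs (λ x → sum< n (f x)) ≡ sum< n (λ k → sumL xs (λ x → f x k))
    sumL-sum< [] n f = sym (sum<-zero n (λ _ _ → refl))
    sumL-sum< (x ∷ xs) n f =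
      trans (cong (sum< n (f x) +_) (sumL-sum< xs n f)) (sym (sum<-+ n (f x) (λ k → sumL xs (λ x' → f x' k))))

    sumL-swap : ∀ {B C : Set} (xs : List B) (ys : List C) (f : B → C → A) →
                sumL xs (λ x → sumL ys (f x)) ≡ sumL ys (λ y → sumL xs (λ x → f x y))
    sumL-swap [] ys f = sym (sumL-zero ys (λ _ _ → refl))
    sumL-swap (x ∷ xs) ys f =
      trans (cong (sumL ys (f x) +_) (sumL-swap xs ys f)) (sym (sumL-+ ys (f x) (λ y → sumL xs (λ x' → f x' y))))

  open RangeSums ℕ._+_ ℕ._*_ 0 ℕP.+-assoc ℕP.+-comm ℕP.+-identityˡ ℕP.*-distribˡ-+ ℕP.*-zeroʳ public
    using ()
    renaming (sum< to sumℕ; sum<-cong to sumℕ-cong; sum<-+ to sumℕ-+; sum<-zero to sumℕ-zero;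
              sum<-split to sumℕ-split; sum<-shrink to sumℕ-shrink; sum<-single to sumℕ-single; sum<-suc to sumℕ-suc;
              sumL to sumLℕ; sumL-cong to sumLℕ-cong; sumL-*ˡ to sumLℕ-*ˡ; sumL-zero to sumLℕ-zero;
              sumL-++ to sumLℕ-++; sumL-map to sumLℕ-map; sumL-sum< to sumLℕ-sumℕ; sumL-swap to sumLℕ-swap;
              +-interchange to +-interchangeℕ)

  open RangeSums ℤ._+_ ℤ._*_ (ℤ.+ 0) ℤP.+-assoc ℤP.+-comm ℤP.+-identityˡ ℤP.*-distribˡ-+ ℤP.*-zeroʳ public
    using ()
    renaming (sum< to sumℤ; sum<-cong to sumℤ-cong; sum<-+ to sumℤ-+; sum<-*ˡ to sumℤ-*ˡ;
              sum<-swap to sumℤ-swap; sum<-split to sumℤ-split; sum<-shrink to sumℤ-shrink;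
              sum<-single to sumℤ-single; sum<-suc to sumℤ-suc)

  sumℕ-mono-≤ : ∀ K {f g} → (∀ j → j < K → f j ≤ g j) → sumℕ K f ≤ sumℕ K g
  sumℕ-mono-≤ zero h = ℕ.z≤n
  sumℕ-mono-≤ (suc K) h = ℕP.+-mono-≤ (sumℕ-mono-≤ K (λ j lt → h j (ℕP.m<n⇒m<1+n lt))) (h K ℕP.≤-refl)

  sumℕ-ℤ : ∀ n f → ℤ.+ (sumℕ n f) ≡ sumℤ n (λ k → ℤ.+ f k)
  sumℕ-ℤ zero f = refl
  sumℕ-ℤ (suc n) f = trans (ℤP.pos-+ (sumℕ n f) (f n)) (cong (ℤ._+ ℤ.+ f n) (sumℕ-ℤ n f))


module PeriodicWords where

  open import Defs using (ℤ₂; _≈₂_)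
  open ParityVector using (Admissible)
  open CycleCorrespondence using (shift; Periodic; ExactPeriod)
  open import Data.Bool using (Bool; true; false)
  open import Data.Bool.Properties using () renaming (_≟_ to _≟ᵇ_)
  open import Data.Nat using (ℕ; zero; suc; _+_; _*_; _≤_; _<_; z≤n; s≤s; NonZero; _%_; _/_; _≤?_)
  open import Data.Nat.Properties using (+-assoc; +-comm; +-suc; allUpTo?)
  open import Data.Nat.DivMod using (m≡m%n+[m/n]*n; m%n<n; m<n⇒m%n≡m; [m+n]%n≡m%n)
  open import Data.Nat.Divisibility using (_∣_; divides)
  open import Data.Vec using (Vec; []; _∷_)
  open import Data.Product using (_,_; proj₁; proj₂)
  open import Relation.Nullary using (Dec; yes; no)
  open import Relation.Nullary.Decidable using (_→-dec_; ¬?)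
  open import Relation.Binary.PropositionalEquality using (_≡_; refl; sym; trans; cong; cong₂; subst)

  periodic-* : ∀ {A : Set} {n} {g : ℕ → A} → Periodic n g → ∀ q r → g (q * n + r) ≡ g r
  periodic-* p zero r = refl
  periodic-* {n = n} {g} p (suc q) r = trans (cong g (+-assoc n (q * n) r)) (trans (p _) (periodic-* p q r))

  periodic-% : ∀ {A : Set} {n} {g : ℕ → A} .{{_ : NonZero n}} → Periodic n g → ∀ i → g i ≡ g (i % n)
  periodic-% {n = n} {g} p i =
    trans (cong g (trans (m≡m%n+[m/n]*n i n) (+-comm (i % n) _))) (periodic-* p (i / n) (i % n))

  periodic-∣ : ∀ {A : Set} {d n} {g : ℕ → A} → Periodic d g → d ∣ n → Periodic n g
  periodic-∣ p (divides q refl) i = periodic-* p q i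

  periodic-%-period : ∀ {A : Set} {d n} {g : ℕ → A} .{{_ : NonZero d}} → Periodic d g → Periodic n g → Periodic (n % d) g
  periodic-%-period {d = d} {n} {g} pd pn i = trans (sym (periodic-* pd (n / d) (n % d + i)))
    (trans (cong g (trans (sym (+-assoc ((n / d) * d) (n % d) i))
                          (cong (_+ i) (trans (+-comm _ (n % d)) (sym (m≡m%n+[m/n]*n n d))))))
           (pn i))

  periodic-all : ∀ {A : Set} {n} {g : ℕ → A} .{{_ : NonZero n}} {P : A → Set} →
                 Periodic n g → (∀ {j} → j < n → P (g j)) → ∀ i → P (g i)
  periodic-all {n = n} {g} {P = P} p h i = subst P (sym (periodic-% p i)) (h (m%n<n i n))

  -- Lookup with a natural-number index; the default false beyond the length is never used.
  lookupℕ : ∀ {n} → Vec Bool n → ℕ → Bool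
  lookupℕ [] i = false
  lookupℕ (x ∷ u) zero = x
  lookupℕ (x ∷ u) (suc i) = lookupℕ u i

  prefix : (n : ℕ) → ℤ₂ → Vec Bool n
  prefix zero w = []
  prefix (suc n) w = w 0 ∷ prefix n (λ i → w (suc i))

  lookupℕ-prefix : ∀ n w i → i < n → lookupℕ (prefix n w) i ≡ w i
  lookupℕ-prefix (suc n) w zero _ = refl
  lookupℕ-prefix (suc n) w (suc i) (s≤s p) = lookupℕ-prefix n (λ i → w (suc i)) i p

  prefix-cong : ∀ n {w w'} → (∀ i → i < n → w i ≡ w' i) → prefix n w ≡ prefix n w'
  prefix-cong zero e = refl
  prefix-cong (suc n) e = cong₂ _∷_ (e 0 (s≤s z≤n)) (prefix-cong n (λ i p → e (suc i) (s≤s p)))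

  prefix-lookupℕ : ∀ {n} (u : Vec Bool n) → prefix n (lookupℕ u) ≡ u
  prefix-lookupℕ [] = refl
  prefix-lookupℕ (x ∷ u) = cong (x ∷_) (prefix-lookupℕ u)

  cycle : ∀ {n} .{{_ : NonZero n}} → Vec Bool n → ℤ₂
  cycle {n} u i = lookupℕ u (i % n)

  cycle-lookupℕ : ∀ {n} .{{_ : NonZero n}} (u : Vec Bool n) i → i < n → cycle u i ≡ lookupℕ u i
  cycle-lookupℕ u i p = cong (lookupℕ u) (m<n⇒m%n≡m p)

  cycle-periodic : ∀ {n} .{{_ : NonZero n}} (u : Vec Bool n) → Periodic n (cycle u)
  cycle-periodic {n} u i = cong (lookupℕ u) (trans (cong (_% n) (+-comm n i)) ([m+n]%n≡m%n i n))

  cycle-prefix : ∀ {n} .{{_ : NonZero n}} {w} → Periodic n w → cycle (prefix n w) ≈₂ w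
  cycle-prefix {n} {w} p i = trans (lookupℕ-prefix n w (i % n) (m%n<n i n)) (sym (periodic-% p i))

  prefix-cycle : ∀ {n} .{{_ : NonZero n}} (u : Vec Bool n) → prefix n (cycle u) ≡ u
  prefix-cycle {n} u = trans (prefix-cong n (λ i p → cycle-lookupℕ u i p)) (prefix-lookupℕ u)

  cycle-injective : ∀ {n} .{{_ : NonZero n}} (u v : Vec Bool n) → cycle u ≈₂ cycle v → u ≡ v
  cycle-injective {n} u v e = trans (sym (prefix-cycle u)) (trans (prefix-cong n (λ i _ → e i)) (prefix-cycle v))

  shift-periodic : ∀ {n k w} → Periodic n w → Periodic n (shift k w)
  shift-periodic {n} {k} {w} p i =
    trans (cong w (trans (sym (+-assoc k n i)) (trans (cong (_+ i) (+-comm k n)) (+-assoc n k i)))) (p (k + i))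

  shift-shift : ∀ a b w → shift a (shift b w) ≈₂ shift (b + a) w
  shift-shift a b w i = cong w (sym (+-assoc b a i))

  periodic-cong : ∀ {n w w'} → w ≈₂ w' → Periodic n w → Periodic n w'
  periodic-cong {n} e p i = trans (sym (e (n + i))) (trans (p i) (e i))

  admissible-cong : ∀ {w w'} → w ≈₂ w' → Admissible w → Admissible w'
  admissible-cong e a i t = trans (sym (e (suc i))) (a i (trans (e i) t))

  exactPeriod-cong : ∀ {n w w'} → w ≈₂ w' → ExactPeriod n w → ExactPeriod n w'
  exactPeriod-cong e (a , p , m) =
    admissible-cong e a , periodic-cong e p , λ k k1 kn q → m k k1 kn (periodic-cong (λ i → sym (e i)) q)

  periodic? : ∀ {n} .{{_ : NonZero n}} (u : Vec Bool n) k → Dec (Periodic k (cycle u))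
  periodic? {n} u k with allUpTo? (λ i → cycle u (k + i) ≟ᵇ cycle u i) n
  ... | yes h = yes (periodic-all {g = λ i → cycle u (k + i) , cycle u i} {P = λ q → proj₁ q ≡ proj₂ q}
                       (λ i → cong₂ _,_ (shift-periodic {k = k} (cycle-periodic u) i) (cycle-periodic u i)) h)
  ... | no ¬h = no λ p → ¬h (λ {i} _ → p i)

  admissible? : ∀ {n} .{{_ : NonZero n}} (u : Vec Bool n) → Dec (Admissible (cycle u))
  admissible? {n} u with allUpTo? (λ i → (cycle u i ≟ᵇ true) →-dec (cycle u (suc i) ≟ᵇ false)) n
  ... | yes h = yes (periodic-all {g = λ i → cycle u i , cycle u (suc i)} {P = λ q → proj₁ q ≡ true → proj₂ q ≡ false}
                       (λ i → cong₂ _,_ (cycle-periodic u i) (trans (cong (cycle u) (sym (+-suc n i))) (cycle-periodic u (suc i))))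
                       h)
  ... | no ¬h = no λ a → ¬h (λ {i} _ → a i)

  exactPeriod? : ∀ {n} .{{_ : NonZero n}} (u : Vec Bool n) → Dec (ExactPeriod n (cycle u))
  exactPeriod? {n} u with admissible? u | periodic? u n | allUpTo? (λ k → (1 ≤? k) →-dec ¬? (periodic? u k)) n
  ... | yes a | yes p | yes m = yes (a , p , λ k k1 kn → m kn k1)
  ... | no ¬a | _ | _ = no λ e → ¬a (proj₁ e)
  ... | _ | no ¬p | _ = no λ e → ¬p (proj₁ (proj₂ e))
  ... | _ | _ | no ¬m = no λ e → ¬m (λ {k} kn k1 → proj₂ (proj₂ e) k k1 kn)


module WordEnumeration where

  open FiniteSums
  open import Data.Bool using (Bool; true; false)
  open import Data.Bool.Properties using () renaming (_≟_ to _≟ᵇ_)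
  open import Data.Nat using (ℕ; zero; suc; _+_; _*_; _≤_; _<_; z≤n; s≤s; _≤?_)
  open import Data.Nat.Properties using (+-identityʳ; +-comm; suc-injective; *-cancelˡ-≡; even≢odd; ≤-reflexive;
    ≤-refl; ≤-trans; ≤-pred; <⇒≤; ≰⇒>; m<n⇒m<1+n; m≤n⇒m<n∨m≡n)
  open import Data.Vec using (Vec; []; _∷_)
  open import Data.Vec.Properties using (∷-injectiveʳ) renaming (≡-dec to ≡-decᵥ)
  open import Data.List using (List; []; _∷_; _++_; map; filter; length)
  open import Data.List.Membership.Propositional using (_∈_)
  open import Data.List.Membership.Propositional.Properties using (∈-++⁺ˡ; ∈-++⁺ʳ; ∈-map⁺)
  open import Data.List.Relation.Unary.All using ([]; universal)
  import Data.List.Relation.Unary.All.Properties as All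
  open import Data.List.Relation.Unary.Any using (here)
  open import Data.List.Relation.Unary.AllPairs as AllPairs using (AllPairs; []; _∷_)
  import Data.List.Relation.Unary.AllPairs.Properties as AllPairs
  open import Data.Product using (_×_; _,_; Σ)
  open import Data.Sum using (_⊎_; inj₁; inj₂)
  open import Data.Empty using (⊥-elim)
  open import Relation.Nullary using (¬_; Dec; yes; no; does)
  open import Relation.Binary.PropositionalEquality using (_≡_; _≢_; refl; sym; trans; cong; cong₂)

  ι : Bool → ℕ
  ι true = 1
  ι false = 0

  ιd : ∀ {P : Set} → Dec P → ℕ
  ιd d = ι (does d)

  ιd-yes : ∀ {P : Set} (d : Dec P) → P → ιd d ≡ 1
  ιd-yes (yes _) _ = refl
  ιd-yes (no ¬p) p = ⊥-elim (¬p p)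

  ιd-no : ∀ {P : Set} (d : Dec P) → ¬ P → ιd d ≡ 0
  ιd-no (yes p) ¬p = ⊥-elim (¬p p)
  ιd-no (no _) _ = refl

  ιd-* : ∀ {P : Set} (d : Dec P) (x : ℕ) → (P → x ≡ 0) → ιd d * x ≡ 0
  ιd-* (yes p) x h = trans (+-identityʳ _) (h p)
  ιd-* (no _) x h = refl

  ιd*≤ : ∀ {P : Set} (d : Dec P) x → ιd d * x ≤ x
  ιd*≤ (yes _) x = ≤-reflexive (+-identityʳ x)
  ιd*≤ (no _) x = z≤n

  _≟ᵥ_ : ∀ {n} (u v : Vec Bool n) → Dec (u ≡ v)
  _≟ᵥ_ = ≡-decᵥ _≟ᵇ_

  δ : ∀ {n} (u v : Vec Bool n) → ℕ
  δ u v = ιd (u ≟ᵥ v)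

  allWords : (n : ℕ) → List (Vec Bool n)
  allWords zero = [] ∷ []
  allWords (suc n) = map (false ∷_) (allWords n) ++ map (true ∷_) (allWords n)

  sumLℕ-map-zero : ∀ {B C : Set} (g : B → C) (xs : List B) (f : C → ℕ) → (∀ x → f (g x) ≡ 0) → sumLℕ (map g xs) f ≡ 0
  sumLℕ-map-zero g xs f e = trans (sumLℕ-map g xs f) (sumLℕ-zero xs (λ x _ → e x))

  prefixed-single : ∀ n b (v : Vec Bool n) (f : Vec Bool (suc n) → ℕ) → (∀ u → u ≢ b ∷ v → f u ≡ 0) →
                    sumLℕ (map (b ∷_) (allWords n)) f ≡ f (b ∷ v)

  allWords-single : ∀ n (v : Vec Bool n) (f : Vec Bool n → ℕ) → (∀ u → u ≢ v → f u ≡ 0) → sumLℕ (allWords n) f ≡ f v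
  allWords-single zero [] f e = +-identityʳ _
  allWords-single (suc n) (false ∷ v) f e =
    trans (sumLℕ-++ (map (false ∷_) (allWords n)) _ f)
          (trans (cong₂ _+_ (prefixed-single n false v f e) (sumLℕ-map-zero (true ∷_) (allWords n) f (λ u → e (true ∷ u) (λ ()))))
                 (+-identityʳ _))
  allWords-single (suc n) (true ∷ v) f e =
    trans (sumLℕ-++ (map (false ∷_) (allWords n)) _ f)
          (cong₂ _+_ (sumLℕ-map-zero (false ∷_) (allWords n) f (λ u → e (false ∷ u) (λ ()))) (prefixed-single n true v f e))

  prefixed-single n b v f e = trans (sumLℕ-map (b ∷_) (allWords n) f)
    (allWords-single n v (λ u → f (b ∷ u)) (λ u u≢v → e (b ∷ u) (λ eq → u≢v (∷-injectiveʳ eq))))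

  allWords-δ : ∀ n (v : Vec Bool n) → sumLℕ (allWords n) (λ u → δ u v) ≡ 1
  allWords-δ n v = trans (allWords-single n v (λ u → δ u v) (λ u ne → ιd-no (u ≟ᵥ v) ne)) (ιd-yes (v ≟ᵥ v) refl)

  allWords-complete : ∀ n (v : Vec Bool n) → v ∈ allWords n
  allWords-complete zero [] = here refl
  allWords-complete (suc n) (false ∷ v) = ∈-++⁺ˡ (∈-map⁺ (false ∷_) (allWords-complete n v))
  allWords-complete (suc n) (true ∷ v) = ∈-++⁺ʳ (map (false ∷_) (allWords n)) (∈-map⁺ (true ∷_) (allWords-complete n v))

  allWords-distinct : ∀ n → AllPairs _≢_ (allWords n)
  allWords-distinct zero = [] ∷ []
  allWords-distinct (suc n) =
    AllPairs.++⁺ (AllPairs.map⁺ (prefix-distinct (allWords-distinct n))) (AllPairs.map⁺ (prefix-distinct (allWords-distinct n)))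
                 (All.map⁺ (universal (λ _ → All.map⁺ (universal (λ _ ()) (allWords n))) (allWords n)))
    where
    prefix-distinct : ∀ {b} {xs : List (Vec Bool n)} → AllPairs _≢_ xs → AllPairs (λ u v → (b ∷ u) ≢ (b ∷ v)) xs
    prefix-distinct = AllPairs.map (λ u≢v eq → u≢v (∷-injectiveʳ eq))

  length-filter : ∀ {B : Set} {P : B → Set} (P? : ∀ x → Dec (P x)) xs → length (filter P? xs) ≡ sumLℕ xs (λ x → ιd (P? x))
  length-filter P? [] = refl
  length-filter P? (x ∷ xs) with P? x
  ... | yes _ = cong suc (length-filter P? xs)
  ... | no _ = length-filter P? xs

  sumℕ-1 : ∀ n → sumℕ n (λ _ → 1) ≡ n
  sumℕ-1 zero = refl
  sumℕ-1 (suc n) = trans (+-comm (sumℕ n (λ _ → 1)) 1) (cong suc (sumℕ-1 n))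

  binaryValue : ∀ {n} → Vec Bool n → ℕ
  binaryValue [] = 0
  binaryValue (b ∷ u) = ι b + 2 * binaryValue u

  binaryValue-injective : ∀ {n} (u v : Vec Bool n) → binaryValue u ≡ binaryValue v → u ≡ v
  binaryValue-injective [] [] e = refl
  binaryValue-injective (true ∷ u) (true ∷ v) e = cong (true ∷_) (binaryValue-injective u v (*-cancelˡ-≡ _ _ 2 (suc-injective e)))
  binaryValue-injective (false ∷ u) (false ∷ v) e = cong (false ∷_) (binaryValue-injective u v (*-cancelˡ-≡ _ _ 2 e))
  binaryValue-injective (true ∷ u) (false ∷ v) e = ⊥-elim (even≢odd (binaryValue v) (binaryValue u) (sym e))
  binaryValue-injective (false ∷ u) (true ∷ v) e = ⊥-elim (even≢odd (binaryValue u) (binaryValue v) e)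

  argmin< : ∀ N → 1 ≤ N → (f : ℕ → ℕ) → Σ ℕ λ k₀ → k₀ < N × (∀ k → k < N → f k₀ ≤ f k)
  argmin< (suc zero) _ f = 0 , s≤s z≤n , λ { zero _ → ≤-refl ; (suc k) (s≤s ()) }
  argmin< (suc (suc N)) _ f with argmin< (suc N) (s≤s z≤n) f
  ... | k₀ , k₀<N , min with f k₀ ≤? f (suc N)
  ...   | yes k₀≤N = k₀ , m<n⇒m<1+n k₀<N , λ k k< → extend k (m≤n⇒m<n∨m≡n (≤-pred k<))
    where
    extend : ∀ k → k < suc N ⊎ k ≡ suc N → f k₀ ≤ f k
    extend k (inj₁ p) = min k p
    extend k (inj₂ refl) = k₀≤N
  ...   | no k₀≰N = suc N , ≤-refl , λ k k< → extend k (m≤n⇒m<n∨m≡n (≤-pred k<))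
    where
    extend : ∀ k → k < suc N ⊎ k ≡ suc N → f (suc N) ≤ f k
    extend k (inj₁ p) = ≤-trans (<⇒≤ (≰⇒> k₀≰N)) (min k p)
    extend k (inj₂ refl) = ≤-refl

module Necklaces where

  open import Defs using (_≈₂_)
  open CycleCorrespondence using (shift; Periodic; ExactPeriod; ShiftRelated; ShiftClassReps)
  open PeriodicWords
  open WordEnumeration
  open FiniteSums
  open import Data.Bool using (Bool)
  open import Data.Nat as ℕ using (ℕ; _+_; _*_; _∸_; _≤_; _<_; z≤n; NonZero; _%_; _≤?_)
  open import Data.Nat.Properties
  open import Data.Nat.DivMod using (m%n<n)
  open import Data.Nat.Tactic.RingSolver using (solve-∀)
  open import Data.Vec using (Vec; []; _∷_)
  open import Data.List using (List; []; _∷_; map; filter; length)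
  open import Data.List.Membership.Propositional using (_∈_)
  open import Data.List.Membership.Propositional.Properties using (∈-filter⁺)
  open import Data.List.Relation.Unary.All using (All; []; _∷_)
  import Data.List.Relation.Unary.All.Properties as AllP
  open import Data.List.Relation.Unary.Any using (Any)
  import Data.List.Relation.Unary.Any as Any
  import Data.List.Relation.Unary.Any.Properties as AnyP
  open import Data.List.Relation.Unary.AllPairs using (AllPairs; []; _∷_)
  import Data.List.Relation.Unary.AllPairs.Properties as AllPairsP
  open import Data.Product using (_×_; _,_; proj₁; proj₂; Σ)
  open import Data.Empty using (⊥; ⊥-elim)
  open import Relation.Nullary using (¬_; Dec; yes; no)
  open import Relation.Nullary.Decidable using (_×-dec_)
  open import Relation.Binary using (tri<; tri≈; tri>)
  open import Relation.Binary.PropositionalEquality using (_≡_; _≢_; refl; sym; trans; cong; subst; module ≡-Reasoning)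

  module OfLength (n : ℕ) .{{nz : NonZero n}} where

    rotate : ℕ → Vec Bool n → Vec Bool n
    rotate k u = prefix n (shift k (cycle u))

    cycle-rotate : ∀ k u → cycle (rotate k u) ≈₂ shift k (cycle u)
    cycle-rotate k u = cycle-prefix (shift-periodic {k = k} (cycle-periodic u))

    rotate-rotate : ∀ a b u → rotate a (rotate b u) ≡ rotate (b + a) u
    rotate-rotate a b u = cycle-injective _ _ λ i → trans (cycle-rotate a (rotate b u) i) (trans (cycle-rotate b u (a + i))
       (trans (shift-shift a b (cycle u) i) (sym (cycle-rotate (b + a) u i))))

    rotate-zero : ∀ u → rotate 0 u ≡ u
    rotate-zero u = prefix-cycle u

    rotate-% : ∀ k u → rotate k u ≡ rotate (k % n) u
    rotate-% k u = prefix-cong n λ i _ →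
      periodic-% {g = λ k → cycle u (k + i)} (λ k → trans (cong (cycle u) (+-assoc n k i)) (cycle-periodic u (k + i))) k

    rotate-period : ∀ u → rotate n u ≡ u
    rotate-period u = trans (prefix-cong n (λ i _ → cycle-periodic u i)) (prefix-cycle u)

    rotate-back : ∀ k u → k ≤ n → rotate (n ∸ k) (rotate k u) ≡ u
    rotate-back k u le = trans (rotate-rotate (n ∸ k) k u) (trans (cong (λ t → rotate t u) (m+[n∸m]≡n le)) (rotate-period u))

    exactPeriod-shift : ∀ k w → ExactPeriod n w → ExactPeriod n (shift k w)
    exactPeriod-shift k w (a , p , m) =
      (λ i t → trans (cong w (+-suc k i)) (a (k + i) t)) , shift-periodic {k = k} p , λ j j1 jn q → m j j1 jn (back j q)
      where
      -- A further shift by c = kn − k brings the total shift to a multiple of the period n.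
      c = k * n ∸ k
      kc : k + c ≡ k * n
      kc = m+[n∸m]≡n (m≤m*n k n)
      back : ∀ j → Periodic j (shift k w) → Periodic j w
      back j q i = begin
        w (j + i)             ≡⟨ sym (periodic-* p k (j + i)) ⟩
        w (k * n + (j + i))   ≡⟨ cong w (trans (cong (_+ (j + i)) (sym kc)) (identity k c j i)) ⟩
        w (k + (j + (c + i))) ≡⟨ q (c + i) ⟩
        w (k + (c + i))       ≡⟨ cong w (trans (sym (+-assoc k c i)) (cong (_+ i) kc)) ⟩
        w (k * n + i)         ≡⟨ periodic-* p k i ⟩
        w i                   ∎
        where
        open ≡-Reasoning
        identity : ∀ k c j i → (k + c) + (j + i) ≡ k + (j + (c + i))
        identity = solve-∀

    exactPeriod-rotate : ∀ k u → ExactPeriod n (cycle u) → ExactPeriod n (cycle (rotate k u))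
    exactPeriod-rotate k u e = exactPeriod-cong (λ i → sym (cycle-rotate k u i)) (exactPeriod-shift k (cycle u) e)

    rotate-≡⇒ : ∀ {k k' r r'} → rotate k r ≡ rotate k' r' → k' ≤ n → r' ≡ rotate ((k + (n ∸ k')) % n) r
    rotate-≡⇒ {k} {k'} {r} {r'} e le = trans (sym (rotate-back k' r' le)) (trans (cong (rotate (n ∸ k')) (sym e))
      (trans (rotate-rotate (n ∸ k') k r) (rotate-% _ r)))

    IsLeastRotation : Vec Bool n → Set
    IsLeastRotation u = ExactPeriod n (cycle u) × (∀ {k} → k < n → binaryValue u ≤ binaryValue (rotate k u))

    leastRotation? : ∀ u → Dec (IsLeastRotation u)
    leastRotation? u = exactPeriod? u ×-dec allUpTo? (λ k → binaryValue u ≤? binaryValue (rotate k u)) n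

    leastRotation-unique : ∀ {r r' k k'} → IsLeastRotation r → IsLeastRotation r' →
                           rotate k r ≡ rotate k' r' → k ≤ n → k' ≤ n → r ≡ r'
    leastRotation-unique {r} {r'} {k} {k'} (_ , mr) (_ , mr') e le le' = binaryValue-injective r r' (≤-antisym r≤r' r'≤r)
      where
      r≤r' : binaryValue r ≤ binaryValue r'
      r≤r' = subst (λ t → binaryValue r ≤ binaryValue t) (sym (rotate-≡⇒ {k} {k'} {r} {r'} e le')) (mr (m%n<n (k + (n ∸ k')) n))
      r'≤r : binaryValue r' ≤ binaryValue r
      r'≤r = subst (λ t → binaryValue r' ≤ binaryValue t) (sym (rotate-≡⇒ {k'} {k} {r'} {r} (sym e) le)) (mr' (m%n<n (k' + (n ∸ k)) n))

    exactPeriod-shifts-differ : ∀ {w k k'} → ExactPeriod n w → (∀ t → w (k + t) ≡ w (k' + t)) → k < k' → k' < n → ⊥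
    exactPeriod-shifts-differ {w} {k} {k'} (a , p , m) h k<k' k'<n = m d (m<n⇒0<n∸m k<k') (≤-<-trans (m∸n≤m k' k) k'<n) pd
      where
      d = k' ∸ k
      c = n ∸ k
      kd : k + d ≡ k'
      kd = m+[n∸m]≡n (<⇒≤ k<k')
      kc : k + c ≡ n
      kc = m+[n∸m]≡n (<⇒≤ (<-trans k<k' k'<n))
      pd : Periodic d w
      pd i = trans (sym (p (d + i))) (trans (cong w e1) (trans (sym (h (c + i))) (trans (cong w e2) (p i))))
        where
        identity : ∀ k c d i → (k + c) + (d + i) ≡ (k + d) + (c + i)
        identity = solve-∀
        e1 : n + (d + i) ≡ k' + (c + i)
        e1 = trans (cong (_+ (d + i)) (sym kc)) (trans (identity k c d i) (cong (_+ (c + i)) kd))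
        e2 : k + (c + i) ≡ n + i
        e2 = trans (sym (+-assoc k c i)) (cong (_+ i) kc)

    rotate-≡⇒shift-≡ : ∀ {r k k'} → rotate k r ≡ rotate k' r → ∀ t → cycle r (k + t) ≡ cycle r (k' + t)
    rotate-≡⇒shift-≡ {r} {k} {k'} e t = trans (sym (cycle-rotate k r t)) (trans (cong (λ v → cycle v t) e) (cycle-rotate k' r t))

    rotate-injective : ∀ {r k k'} → ExactPeriod n (cycle r) → rotate k r ≡ rotate k' r → k < n → k' < n → k ≡ k'
    rotate-injective {r} {k} {k'} ex e kn k'n with <-cmp k k'
    ... | tri≈ _ eq _ = eq
    ... | tri< lt _ _ = ⊥-elim (exactPeriod-shifts-differ ex (rotate-≡⇒shift-≡ {r} e) lt k'n)
    ... | tri> _ _ gt = ⊥-elim (exactPeriod-shifts-differ ex (rotate-≡⇒shift-≡ {r} (sym e)) gt kn)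

    leastRotation-exists : ∀ u → ExactPeriod n (cycle u) →
                           Σ (Vec Bool n) λ r → IsLeastRotation r × Σ ℕ λ j → j < n × u ≡ rotate j r
    leastRotation-exists u ex with argmin< n (ℕ.>-nonZero⁻¹ n) (λ k → binaryValue (rotate k u))
    ... | k₀ , k₀<n , h = rotate k₀ u , (exactPeriod-rotate k₀ u ex , mn) , ((n ∸ k₀) % n) , m%n<n _ n ,
           trans (sym (rotate-back k₀ u (<⇒≤ k₀<n))) (rotate-% _ (rotate k₀ u))
      where
      mn : ∀ {k} → k < n → binaryValue (rotate k₀ u) ≤ binaryValue (rotate k (rotate k₀ u))
      mn {k} _ = subst (λ t → binaryValue (rotate k₀ u) ≤ binaryValue t) (sym (trans (rotate-rotate k k₀ u) (rotate-% _ u)))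
                       (h _ (m%n<n _ n))

    ιleast : Vec Bool n → ℕ
    ιleast r = ιd (leastRotation? r)

    -- A word of exact period n is a rotation of exactly one least rotation, by exactly one k < n.
    ιexactPeriod-as-sum : ∀ u → ιd (exactPeriod? u) ≡ sumLℕ (allWords n) (λ r → ιleast r * sumℕ n (λ k → δ u (rotate k r)))
    ιexactPeriod-as-sum u with exactPeriod? u
    ... | no ¬ex = sym (sumLℕ-zero (allWords n) λ r _ → otherRoots r)
      where
      otherRoots : ∀ r → ιleast r * sumℕ n (λ k → δ u (rotate k r)) ≡ 0
      otherRoots r = ιd-* (leastRotation? r) _ λ { (exr , _) → sumℕ-zero n λ k _ →
               ιd-no (u ≟ᵥ rotate k r) λ { refl → ¬ex (exactPeriod-rotate k r exr) } }
    ... | yes ex with leastRotation-exists u ex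
    ...   | r₀ , rep₀ , j₀ , j₀<n , ue = sym (trans (allWords-single n r₀ _ otherRoots) leastRoot)
      where
      otherRoots : ∀ r → r ≢ r₀ → ιleast r * sumℕ n (λ k → δ u (rotate k r)) ≡ 0
      otherRoots r ne = ιd-* (leastRotation? r) _ λ rep → sumℕ-zero n λ k k<n → ιd-no (u ≟ᵥ rotate k r)
              λ e → ne (leastRotation-unique rep rep₀ (trans (sym e) ue) (<⇒≤ k<n) (<⇒≤ j₀<n))
      leastRoot : ιleast r₀ * sumℕ n (λ k → δ u (rotate k r₀)) ≡ 1
      leastRoot rewrite ιd-yes (leastRotation? r₀) rep₀ = trans (+-identityʳ _) (trans (sumℕ-single n j₀ j₀<n λ k k<n ne → ιd-no (u ≟ᵥ rotate k r₀)
              λ e → ne (rotate-injective {r₀} (proj₁ rep₀) (trans (sym e) ue) k<n j₀<n)) (ιd-yes (u ≟ᵥ rotate j₀ r₀) ue))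

    count-exactPeriod : sumLℕ (allWords n) (λ u → ιd (exactPeriod? u)) ≡ n * sumLℕ (allWords n) ιleast
    count-exactPeriod = begin
      sumLℕ W (λ u → ιd (exactPeriod? u))
        ≡⟨ sumLℕ-cong W (λ u _ → ιexactPeriod-as-sum u) ⟩
      sumLℕ W (λ u → sumLℕ W (λ r → ιleast r * sumℕ n (λ k → δ u (rotate k r))))
        ≡⟨ sumLℕ-swap W W _ ⟩
      sumLℕ W (λ r → sumLℕ W (λ u → ιleast r * sumℕ n (λ k → δ u (rotate k r))))
        ≡⟨ sumLℕ-cong W (λ r _ → sumLℕ-*ˡ W (ιleast r) _) ⟩
      sumLℕ W (λ r → ιleast r * sumLℕ W (λ u → sumℕ n (λ k → δ u (rotate k r))))
        ≡⟨ sumLℕ-cong W (λ r _ → cong (ιleast r *_) (sumLℕ-sumℕ W n _)) ⟩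
      sumLℕ W (λ r → ιleast r * sumℕ n (λ k → sumLℕ W (λ u → δ u (rotate k r))))
        ≡⟨ sumLℕ-cong W (λ r _ → cong (ιleast r *_) (trans (sumℕ-cong n (λ k _ → allWords-δ n (rotate k r))) (sumℕ-1 n))) ⟩
      sumLℕ W (λ r → ιleast r * n)
        ≡⟨ sumLℕ-cong W (λ r _ → *-comm (ιleast r) n) ⟩
      sumLℕ W (λ r → n * ιleast r)
        ≡⟨ sumLℕ-*ˡ W n ιleast ⟩
      n * sumLℕ W ιleast ∎
      where
      open ≡-Reasoning
      W = allWords n

    leastRotations : List (Vec Bool n)
    leastRotations = filter leastRotation? (allWords n)

    length-leastRotations : length leastRotations ≡ sumLℕ (allWords n) ιleast
    length-leastRotations = length-filter leastRotation? (allWords n)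

    allLeast : All IsLeastRotation leastRotations
    allLeast = AllP.all-filter leastRotation? (allWords n)

    leastRotations-unrelated : ∀ {r r'} → IsLeastRotation r → IsLeastRotation r' → r ≢ r' → ¬ ShiftRelated (cycle r) (cycle r')
    leastRotations-unrelated {r} {r'} rp rp' ne (k , e) = ne (leastRotation-unique {k = k % n} {k' = 0} rp rp'
       (trans (sym (rotate-% k r)) (trans (trans (prefix-cong n (λ i _ → e i)) (prefix-cycle r')) (sym (rotate-zero r')))) (<⇒≤ (m%n<n k n)) z≤n)

    leastRotations-pairwise-unrelated : ∀ xs → AllPairs _≢_ xs → All IsLeastRotation xs →
                                        AllPairs (λ w w' → ¬ ShiftRelated w w') (map cycle xs)
    leastRotations-pairwise-unrelated [] [] [] = []
    leastRotations-pairwise-unrelated (x ∷ xs) (p ∷ ps) (q ∷ qs) = go xs p qs ∷ leastRotations-pairwise-unrelated xs ps qs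
      where
      go : ∀ ys → All (x ≢_) ys → All IsLeastRotation ys → All (λ w' → ¬ ShiftRelated (cycle x) w') (map cycle ys)
      go [] [] [] = []
      go (y ∷ ys) (a ∷ as) (b ∷ bs) = leastRotations-unrelated q b a ∷ go ys as bs

    shiftClassReps : ShiftClassReps n
    shiftClassReps = record
      { reps = map cycle leastRotations
      ; allExact = AllP.map⁺ (Data.List.Relation.Unary.All.map proj₁ allLeast)
      ; distinct = leastRotations-pairwise-unrelated leastRotations (AllPairsP.filter⁺ leastRotation? (allWords-distinct n)) allLeast
      ; complete = comp
      }
      where
      comp : ∀ w → ExactPeriod n w → Any (λ r → ShiftRelated r w) (map cycle leastRotations)
      comp w ex with leastRotation-exists (prefix n w) (exactPeriod-cong (λ i → sym (cycle-prefix (proj₁ (proj₂ ex)) i)) ex)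
      ... | r₀ , rep₀ , j₀ , _ , ue = AnyP.map⁺ (Any.map (λ { refl → j₀ , λ i → trans (sym (cycle-rotate j₀ r₀ i))
              (trans (cong (λ v → cycle v i) (sym ue)) (cycle-prefix (proj₁ (proj₂ ex)) i)) }) (∈-filter⁺ leastRotation? (allWords-complete n r₀) rep₀))

    period*count≡exactWords : n * length leastRotations ≡ sumLℕ (allWords n) (λ u → ιd (exactPeriod? u))
    period*count≡exactWords = trans (cong (n *_) length-leastRotations) (sym count-exactPeriod)


module PrimitivePeriods where

  open import Defs using (_≈₂_)
  open ParityVector using (Admissible)
  open CycleCorrespondence using (Periodic; ExactPeriod)
  open PeriodicWords
  open WordEnumeration
  open FiniteSums
  open import Data.Bool using (Bool)
  open import Data.Nat as ℕ using (ℕ; zero; suc; _*_; _≤_; _<_; z≤n; s≤s; NonZero; _%_)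
  open import Data.Nat.Properties using (<-cmp; ≤-refl; ≤-pred; +-identityʳ; *-identityʳ; m≤n⇒m≤1+n; m≤n⇒m<n∨m≡n)
  open import Data.Nat.DivMod using (m%n<n)
  open import Data.Nat.Divisibility using (_∣_; _∣?_; m%n≡0⇒n∣m)
  open import Data.Vec using (Vec)
  open import Data.Product using (_×_; _,_; proj₁; proj₂; Σ)
  open import Data.Sum using (_⊎_; inj₁; inj₂)
  open import Data.Empty using (⊥-elim)
  open import Relation.Nullary using (¬_; Dec; yes; no)
  open import Relation.Binary using (tri<; tri≈; tri>)
  open import Relation.Binary.PropositionalEquality using (_≡_; _≢_; refl; sym; trans; cong; subst; module ≡-Reasoning)

  exactPeriod-∣ : ∀ {d n w} → ExactPeriod (suc d) w → Periodic n w → suc d ∣ n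
  exactPeriod-∣ {d} {n} {w} (_ , p , minimal) pn with n % suc d in eq
  ... | zero = m%n≡0⇒n∣m n (suc d) eq
  ... | suc r = ⊥-elim (minimal (suc r) (s≤s z≤n) (subst (_< suc d) eq (m%n<n n (suc d)))
                                (subst (λ t → Periodic t w) eq (periodic-%-period p pn)))

  exactPeriod-unique : ∀ {d d' w} → ExactPeriod (suc d) w → ExactPeriod (suc d') w → d ≡ d'
  exactPeriod-unique {d} {d'} (_ , p , m) (_ , p' , m') with <-cmp d d'
  ... | tri≈ _ e _ = e
  ... | tri< lt _ _ = ⊥-elim (m' (suc d) (s≤s z≤n) (s≤s lt) p)
  ... | tri> _ _ gt = ⊥-elim (m (suc d') (s≤s z≤n) (s≤s gt) p')

  least-or-none : ∀ N {P : ℕ → Set} → (∀ k → Dec (P k)) →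
    (∀ k → 1 ≤ k → k ≤ N → ¬ P k) ⊎ (Σ ℕ λ k → suc k ≤ N × P (suc k) × (∀ j → 1 ≤ j → j < suc k → ¬ P j))
  least-or-none zero d = inj₁ λ { (suc _) _ () }
  least-or-none (suc N) {P} d with least-or-none N d
  ... | inj₂ (k , k≤ , pk , mk) = inj₂ (k , m≤n⇒m≤1+n k≤ , pk , mk)
  ... | inj₁ none with d (suc N)
  ...   | yes pN = inj₂ (N , ≤-refl , pN , λ j j1 j< → none j j1 (≤-pred j<))
  ...   | no ¬pN = inj₁ λ k k1 k≤ pk → below-or-at (m≤n⇒m<n∨m≡n k≤) k1 pk
    where
    below-or-at : ∀ {k} → k < suc N ⊎ k ≡ suc N → 1 ≤ k → P k → _
    below-or-at {k} (inj₁ lt) k1 pk = none k k1 (≤-pred lt) pk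
    below-or-at (inj₂ refl) k1 pk = ¬pN pk

  exactWordCount : ℕ → ℕ
  exactWordCount k = sumLℕ (allWords (suc k)) (λ v → ιd (exactPeriod? v))

  module ByExactPeriod (n : ℕ) .{{nz : NonZero n}} where

    rootCount : Vec Bool n → ℕ → ℕ
    rootCount u k = ιd (suc k ∣? n) * sumLℕ (allWords (suc k)) (λ v → ιd (exactPeriod? v) * δ u (prefix n (cycle v)))

    cycle-prefix-cycle : ∀ {k} {u : Vec Bool n} {v : Vec Bool (suc k)} → suc k ∣ n → u ≡ prefix n (cycle v) → cycle u ≈₂ cycle v
    cycle-prefix-cycle {v = v} dv refl = cycle-prefix (periodic-∣ (cycle-periodic v) dv)

    minimalPeriod : ∀ (u : Vec Bool n) → Admissible (cycle u) → Σ ℕ λ k → suc k ≤ n × ExactPeriod (suc k) (cycle u)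
    minimalPeriod u a with least-or-none n (periodic? u)
    ... | inj₁ none = ⊥-elim (none n (ℕ.>-nonZero⁻¹ n) ≤-refl (cycle-periodic u))
    ... | inj₂ (k , k≤ , pk , mk) = k , k≤ , a , pk , mk

    rootCount-off : ∀ u k → (∀ {v : Vec Bool (suc k)} → suc k ∣ n → ExactPeriod (suc k) (cycle v) → u ≢ prefix n (cycle v)) →
                    rootCount u k ≡ 0
    rootCount-off u k h = ιd-* (suc k ∣? n) _ λ dv → sumLℕ-zero (allWords (suc k)) λ v _ →
      ιd-* (exactPeriod? v) _ λ ex → ιd-no (u ≟ᵥ prefix n (cycle v)) (h {v} dv ex)

    rootCount-minimal : ∀ u k → ExactPeriod (suc k) (cycle u) → rootCount u k ≡ 1
    rootCount-minimal u k ex rewrite ιd-yes (suc k ∣? n) (exactPeriod-∣ ex (cycle-periodic u)) =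
      trans (+-identityʳ _) (trans (allWords-single (suc k) root _ others) atRoot)
      where
      k∣n = exactPeriod-∣ ex (cycle-periodic u)
      root = prefix (suc k) (cycle u)
      cycle-root : cycle root ≈₂ cycle u
      cycle-root = cycle-prefix (proj₁ (proj₂ ex))
      others : ∀ v → v ≢ root → ιd (exactPeriod? v) * δ u (prefix n (cycle v)) ≡ 0
      others v v≢root = ιd-* (exactPeriod? v) _ λ _ → ιd-no (u ≟ᵥ prefix n (cycle v)) λ e →
        v≢root (trans (sym (prefix-cycle v)) (prefix-cong (suc k) (λ i _ → sym (cycle-prefix-cycle {v = v} k∣n e i))))
      atRoot : ιd (exactPeriod? root) * δ u (prefix n (cycle root)) ≡ 1
      atRoot rewrite ιd-yes (exactPeriod? root) (exactPeriod-cong (λ i → sym (cycle-root i)) ex) =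
        trans (+-identityʳ _) (ιd-yes (u ≟ᵥ prefix n (cycle root))
                                      (trans (sym (prefix-cycle u)) (prefix-cong n (λ i _ → sym (cycle-root i)))))

    -- An admissible word u is the n-prefix of the cycle of exactly one word of exact period dividing n,
    -- namely its prefix of length equal to the minimal period of cycle u.
    ιadmissible-as-sum : ∀ u → ιd (admissible? u) ≡ sumℕ n (rootCount u)
    ιadmissible-as-sum u with admissible? u
    ... | no ¬a = sym (sumℕ-zero n λ k _ → rootCount-off u k λ {v} dv ex e →
                    ¬a (admissible-cong (λ i → sym (cycle-prefix-cycle {v = v} dv e i)) (proj₁ ex)))
    ... | yes a with minimalPeriod u a
    ...   | k₀ , k₀<n , ex₀ = sym (trans (sumℕ-single n k₀ k₀<n λ k _ k≢k₀ → rootCount-off u k λ {v} dv ex e →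
                                            k≢k₀ (exactPeriod-unique (exactPeriod-cong (λ i → sym (cycle-prefix-cycle {v = v} dv e i)) ex) ex₀))
                                         (rootCount-minimal u k₀ ex₀))

    admissibleWords-by-exactPeriod : sumLℕ (allWords n) (λ u → ιd (admissible? u)) ≡ sumℕ n (λ k → ιd (suc k ∣? n) * exactWordCount k)
    admissibleWords-by-exactPeriod = begin
      sumLℕ (allWords n) (λ u → ιd (admissible? u))        ≡⟨ sumLℕ-cong (allWords n) (λ u _ → ιadmissible-as-sum u) ⟩
      sumLℕ (allWords n) (λ u → sumℕ n (rootCount u))      ≡⟨ sumLℕ-sumℕ (allWords n) n rootCount ⟩
      sumℕ n (λ k → sumLℕ (allWords n) (λ u → rootCount u k)) ≡⟨ sumℕ-cong n (λ k _ → sum-rootCount k) ⟩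
      sumℕ n (λ k → ιd (suc k ∣? n) * exactWordCount k)    ∎
      where
      open ≡-Reasoning
      sum-rootCount : ∀ k → sumLℕ (allWords n) (λ u → rootCount u k) ≡ ιd (suc k ∣? n) * exactWordCount k
      sum-rootCount k = trans (sumLℕ-*ˡ (allWords n) (ιd (suc k ∣? n)) _) (cong (ιd (suc k ∣? n) *_)
        (trans (sumLℕ-swap (allWords n) (allWords (suc k)) _) (sumLℕ-cong (allWords (suc k)) λ v _ →
          trans (sumLℕ-*ˡ (allWords n) (ιd (exactPeriod? v)) _)
                (trans (cong (ιd (exactPeriod? v) *_) (allWords-δ n (prefix n (cycle v)))) (*-identityʳ _)))))


module AdmissibleWords where

  open ParityVector using (Admissible)
  open PeriodicWords
  open WordEnumeration
  open FiniteSums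
  open import Data.Bool using (Bool; true; false; not; _∧_)
  open import Data.Bool.Properties using (∧-zeroʳ; ∧-identityʳ)
  open import Data.Nat using (ℕ; zero; suc; _+_; _≤_; z≤n; s≤s)
  open import Data.Nat.Properties using (+-identityʳ; +-suc; ≤-pred; <⇒≤; m≤n⇒m≤1+n; m≤n⇒m<n∨m≡n)
  open import Data.Vec using (Vec; []; _∷_)
  open import Data.List using (map)
  open import Data.Product using (_×_; _,_; proj₁; proj₂)
  open import Data.Sum using (inj₁; inj₂)
  open import Data.Empty using (⊥-elim)
  open import Relation.Nullary using (Dec; yes; no)
  open import Relation.Binary.PropositionalEquality using (_≡_; refl; sym; trans; cong; cong₂)

  fib : ℕ → ℕ
  fib zero = 0
  fib (suc zero) = 1
  fib (suc (suc n)) = fib (suc n) + fib n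

  lucas : ℕ → ℕ
  lucas zero = 2
  lucas (suc m) = fib (suc (suc m)) + fib m

  noAdjacentOnes : ∀ {k} → Bool → Vec Bool k → Bool → Bool
  noAdjacentOnes a [] b = not (a ∧ b)
  noAdjacentOnes a (x ∷ u) b = not (a ∧ x) ∧ noAdjacentOnes x u b

  countNoAdjacentOnes : ℕ → Bool → Bool → ℕ
  countNoAdjacentOnes k a b = sumLℕ (allWords k) (λ u → ι (noAdjacentOnes a u b))

  fibCount : ℕ → Bool → Bool → ℕ
  fibCount k false false = fib (suc (suc k))
  fibCount k false true  = fib (suc k)
  fibCount k true  false = fib (suc k)
  fibCount k true  true  = fib k

  countNoAdjacentOnes-suc : ∀ k a b → countNoAdjacentOnes (suc k) a b ≡
    countNoAdjacentOnes k false b + sumLℕ (allWords k) (λ u → ι (not a ∧ noAdjacentOnes true u b))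
  countNoAdjacentOnes-suc k a b = trans (sumLℕ-++ (map (false ∷_) (allWords k)) _ _)
    (cong₂ _+_ (trans (sumLℕ-map _ (allWords k) _)
                      (sumLℕ-cong (allWords k) (λ u _ → cong (λ t → ι (not t ∧ noAdjacentOnes false u b)) (∧-zeroʳ a))))
               (trans (sumLℕ-map _ (allWords k) _)
                      (sumLℕ-cong (allWords k) (λ u _ → cong (λ t → ι (not t ∧ noAdjacentOnes true u b)) (∧-identityʳ a)))))

  countNoAdjacentOnes≡fibCount : ∀ k a b → countNoAdjacentOnes k a b ≡ fibCount k a b
  countNoAdjacentOnes≡fibCount zero false false = refl
  countNoAdjacentOnes≡fibCount zero false true = refl
  countNoAdjacentOnes≡fibCount zero true false = refl
  countNoAdjacentOnes≡fibCount zero true true = refl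
  countNoAdjacentOnes≡fibCount (suc k) false b =
    trans (countNoAdjacentOnes-suc k false b)
          (trans (cong₂ _+_ (countNoAdjacentOnes≡fibCount k false b) (countNoAdjacentOnes≡fibCount k true b)) (fib-step b))
    where
    fib-step : ∀ b → fibCount k false b + fibCount k true b ≡ fibCount (suc k) false b
    fib-step false = refl
    fib-step true = refl
  countNoAdjacentOnes≡fibCount (suc k) true b =
    trans (countNoAdjacentOnes-suc k true b)
          (trans (cong₂ _+_ (countNoAdjacentOnes≡fibCount k false b) (sumLℕ-zero (allWords k) (λ _ _ → refl))) (fib-step b))
    where
    fib-step : ∀ b → fibCount k false b + 0 ≡ fibCount (suc k) true b
    fib-step false = +-identityʳ _
    fib-step true = +-identityʳ _

  -- Only positions up to k + 1 matter; beyond them the last letter b is repeated.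
  framed : ∀ {k} → Bool → Vec Bool k → Bool → ℕ → Bool
  framed a u b zero = a
  framed a [] b (suc j) = b
  framed a (x ∷ u) b (suc j) = framed x u b j

  ∧-true : ∀ {p q} → p ∧ q ≡ true → p ≡ true × q ≡ true
  ∧-true {true} {true} _ = refl , refl

  noAdjacentOnes⇒ : ∀ {k} a (u : Vec Bool k) b → noAdjacentOnes a u b ≡ true →
                    ∀ j → j ≤ k → framed a u b j ≡ true → framed a u b (suc j) ≡ false
  noAdjacentOnes⇒ true [] true () j le e
  noAdjacentOnes⇒ true [] false c zero le e = refl
  noAdjacentOnes⇒ a (x ∷ u) b c zero le e with ∧-true {not (a ∧ x)} c
  ... | c₀ , _ with a | x | e
  ...   | true | true | _ with () ← c₀
  ...   | true | false | _ = refl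
  noAdjacentOnes⇒ a (x ∷ u) b c (suc j) (s≤s le) e = noAdjacentOnes⇒ x u b (proj₂ (∧-true {not (a ∧ x)} c)) j le e

  noAdjacentOnes⇐ : ∀ {k} a (u : Vec Bool k) b →
                    (∀ j → j ≤ k → framed a u b j ≡ true → framed a u b (suc j) ≡ false) → noAdjacentOnes a u b ≡ true
  noAdjacentOnes⇐ true [] true h with () ← h 0 z≤n refl
  noAdjacentOnes⇐ true [] false h = refl
  noAdjacentOnes⇐ false [] b h = refl
  noAdjacentOnes⇐ a (x ∷ u) b h = cong₂ _∧_ (first a x (h 0 z≤n)) (noAdjacentOnes⇐ x u b (λ j le → h (suc j) (s≤s le)))
    where
    first : ∀ a x → (a ≡ true → x ≡ false) → not (a ∧ x) ≡ true
    first true true f with () ← f refl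
    first true false f = refl
    first false x f = refl

  framed-lookupℕ : ∀ {k} a (u : Vec Bool k) b j → j ≤ k → framed a u b j ≡ lookupℕ (a ∷ u) j
  framed-lookupℕ a u b zero _ = refl
  framed-lookupℕ a (x ∷ u) b (suc j) (s≤s le) = framed-lookupℕ x u b j le

  framed-end : ∀ {k} a (u : Vec Bool k) b → framed a u b (suc k) ≡ b
  framed-end a [] b = refl
  framed-end a (x ∷ u) b = framed-end x u b

  -- Over one period, the cycle of x ∷ v is the frame x v x: the last letter wraps around to the first.
  module _ {m : ℕ} (x : Bool) (v : Vec Bool m) where

    cycle-framed : ∀ j → j ≤ suc m → cycle (x ∷ v) j ≡ framed x v x j
    cycle-framed j le with m≤n⇒m<n∨m≡n le
    ... | inj₁ lt = trans (cycle-lookupℕ (x ∷ v) j lt) (sym (framed-lookupℕ x v x j (≤-pred lt)))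
    ... | inj₂ refl = trans (trans (cong (cycle (x ∷ v)) (sym (+-identityʳ (suc m)))) (cycle-periodic (x ∷ v) 0))
                            (sym (framed-end x v x))

    admissible⇒noAdjacentOnes : Admissible (cycle (x ∷ v)) → noAdjacentOnes x v x ≡ true
    admissible⇒noAdjacentOnes a = noAdjacentOnes⇐ x v x λ j le e →
      trans (sym (cycle-framed (suc j) (s≤s le))) (a j (trans (cycle-framed j (m≤n⇒m≤1+n le)) e))

    noAdjacentOnes⇒admissible : noAdjacentOnes x v x ≡ true → Admissible (cycle (x ∷ v))
    noAdjacentOnes⇒admissible c =
      periodic-all {g = λ i → cycle u i , cycle u (suc i)} {P = λ q → proj₁ q ≡ true → proj₂ q ≡ false}
        (λ i → cong₂ _,_ (cycle-periodic u i) (trans (cong (cycle u) (sym (+-suc (suc m) i))) (cycle-periodic u (suc i))))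
        (λ {j} j<n e → trans (cycle-framed (suc j) j<n)
                             (noAdjacentOnes⇒ x v x c j (≤-pred j<n) (trans (sym (cycle-framed j (<⇒≤ j<n))) e)))
      where u = x ∷ v

  ιd-≡-ι : ∀ {P : Set} (d : Dec P) b → (P → b ≡ true) → (b ≡ true → P) → ιd d ≡ ι b
  ιd-≡-ι (yes p) b f g = cong ι (sym (f p))
  ιd-≡-ι (no ¬p) true f g = ⊥-elim (¬p (g refl))
  ιd-≡-ι (no ¬p) false f g = refl

  admissibleWords≡lucas : ∀ m → sumLℕ (allWords (suc m)) (λ u → ιd (admissible? u)) ≡ lucas (suc m)
  admissibleWords≡lucas m = trans (sumLℕ-++ (map (false ∷_) (allWords m)) _ _)
    (cong₂ _+_ (startingWith false) (startingWith true))
    where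
    startingWith : ∀ x → sumLℕ (map (x ∷_) (allWords m)) (λ u → ιd (admissible? u)) ≡ fibCount m x x
    startingWith x = trans (sumLℕ-map _ (allWords m) _)
      (trans (sumLℕ-cong (allWords m) (λ v _ → ιd-≡-ι (admissible? (x ∷ v)) _ (admissible⇒noAdjacentOnes x v)
                                                                              (noAdjacentOnes⇒admissible x v)))
             (countNoAdjacentOnes≡fibCount m x x))


module MobiusPrimeFactor where

  open import Defs using (μ; primeDivisors; squarefreeᵇ)
  open FiniteSums
  open WordEnumeration using (ι)
  open import Data.Bool using (Bool; true; false; not; _∧_; if_then_else_; T)
  open import Data.Bool.Properties using (T-∧; not-injective; ∧-zeroʳ)
  open import Data.Nat as ℕ using (ℕ; zero; suc; _+_; _*_; _≤_; _<_; s≤s)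
  open import Data.Nat.Properties
  open import Data.Nat.Divisibility
  import Data.Nat.Coprimality as Cop
  open import Data.Nat.Primality using (Prime; prime?; euclidsLemma; prime⇒irreducible; prime⇒nonZero)
  open import Data.Integer as ℤ using (ℤ; +_; -[1+_])
  import Data.Integer.Properties as ℤP
  open import Data.List using (List; []; _∷_; length; filterᵇ; upTo; applyUpTo; foldr)
  open import Data.List.Membership.Propositional using (_∈_)
  open import Data.List.Membership.Propositional.Properties using (∈-filter⁺; ∈-filter⁻; ∈-upTo⁺)
  open import Data.List.Relation.Unary.Any using (here; there)
  open import Data.Product using (_×_; _,_)
  open import Data.Sum using (inj₁; inj₂)
  open import Data.Empty using (⊥-elim)
  open import Function using (_∘_; Equivalence)
  open import Relation.Nullary using (¬_; Dec; yes; no; does)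
  open import Relation.Nullary.Decidable using (T?; dec-true; dec-false)
  open import Relation.Binary.PropositionalEquality using (_≡_; _≢_; refl; sym; trans; cong; cong₂; subst; module ≡-Reasoning)

  length-filterᵇ-applyUpTo : ∀ K (f : ℕ → ℕ) (P : ℕ → Bool) →
                             length (filterᵇ P (applyUpTo f K)) ≡ sumℕ K (λ q → ι (P (f q)))
  length-filterᵇ-applyUpTo zero f P = refl
  length-filterᵇ-applyUpTo (suc K) f P with P (f 0) in eq
  ... | true = trans (cong suc (length-filterᵇ-applyUpTo K (f ∘ suc) P)) (sym (trans (sumℕ-suc K _) (first eq)))
    where first = cong (λ b → ι b + sumℕ K (λ q → ι (P (f (suc q)))))
  ... | false = trans (length-filterᵇ-applyUpTo K (f ∘ suc) P) (sym (trans (sumℕ-suc K _) (first eq)))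
    where first = cong (λ b → ι b + sumℕ K (λ q → ι (P (f (suc q)))))

  T-does⇒ : ∀ {P : Set} (d : Dec P) → T (does d) → P
  T-does⇒ (yes p) _ = p

  T-does⇐ : ∀ {P : Set} (d : Dec P) → P → T (does d)
  T-does⇐ d p rewrite dec-true d p = _

  isPrimeDivisorᵇ : ℕ → ℕ → Bool
  isPrimeDivisorᵇ q d = does (prime? q) ∧ does (q ∣? d)

  ∈-primeDivisors⁻ : ∀ {q d} → q ∈ primeDivisors d → Prime q × q ∣ d
  ∈-primeDivisors⁻ {q} {d} m with ∈-filter⁻ (T? ∘ λ p → isPrimeDivisorᵇ p d) {xs = upTo (suc d)} m
  ... | _ , t with Equivalence.to (T-∧ {does (prime? q)} {does (q ∣? d)}) t
  ...   | t1 , t2 = T-does⇒ (prime? q) t1 , T-does⇒ (q ∣? d) t2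

  ∈-primeDivisors⁺ : ∀ {q d} → q < suc d → Prime q → q ∣ d → q ∈ primeDivisors d
  ∈-primeDivisors⁺ {q} {d} lt pq qd = ∈-filter⁺ (T? ∘ λ p → isPrimeDivisorᵇ p d) (∈-upTo⁺ lt) 
    (Equivalence.from (T-∧ {does (prime? q)} {does (q ∣? d)}) (T-does⇐ (prime? q) pq , T-does⇐ (q ∣? d) qd))

  foldr-∧-true⇒ : ∀ (g : ℕ → Bool) L → foldr (λ p b → g p ∧ b) true L ≡ true → ∀ q → q ∈ L → g q ≡ true
  foldr-∧-true⇒ g (x ∷ L) e q (here refl) with g x
  ... | true = refl
  foldr-∧-true⇒ g (x ∷ L) e q (there m) with g x
  ... | true = foldr-∧-true⇒ g L e q m

  foldr-∧-true⇐ : ∀ (g : ℕ → Bool) L → (∀ q → q ∈ L → g q ≡ true) → foldr (λ p b → g p ∧ b) true L ≡ true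
  foldr-∧-true⇐ g [] h = refl
  foldr-∧-true⇐ g (x ∷ L) h rewrite h x (here refl) = foldr-∧-true⇐ g L (λ q m → h q (there m))

  SquareFree : ℕ → Set
  SquareFree d = ∀ q → Prime q → q ∣ d → ¬ (q * q ∣ d)

  squarefreeᵇ⇒SquareFree : ∀ d → 1 ≤ d → squarefreeᵇ d ≡ true → SquareFree d
  squarefreeᵇ⇒SquareFree d@(suc _) _ e q pq qd qqd
    with () ← trans (sym (not-injective (foldr-∧-true⇒ _ (primeDivisors d) e q (∈-primeDivisors⁺ (s≤s (∣⇒≤ qd)) pq qd))))
                    (dec-true (q * q ∣? d) qqd)

  SquareFree⇒squarefreeᵇ : ∀ d → SquareFree d → squarefreeᵇ d ≡ true
  SquareFree⇒squarefreeᵇ d h = foldr-∧-true⇐ _ (primeDivisors d) λ q m →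
    let (pq , q∣d) = ∈-primeDivisors⁻ {q} {d} m in cong not (dec-false (q * q ∣? d) (h q pq q∣d))

  prime∣prime⇒≡ : ∀ {q p} → Prime q → Prime p → q ∣ p → q ≡ p
  prime∣prime⇒≡ {q} {p} pq pp qp with prime⇒irreducible pp qp
  ... | inj₂ e = e
  ... | inj₁ refl with pq
  ...   | Data.Nat.Primality.prime {{()}} _

  prime⇒1≤ : ∀ {p} → Prime p → 1 ≤ p
  prime⇒1≤ pp = ℕ.>-nonZero⁻¹ _ {{prime⇒nonZero pp}}

  length-primeDivisors : ∀ d → length (primeDivisors d) ≡ sumℕ (suc d) (λ q → ι (isPrimeDivisorᵇ q d))
  length-primeDivisors d = length-filterᵇ-applyUpTo (suc d) (λ x → x) (λ p → isPrimeDivisorᵇ p d)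

  isPrimeDivisorᵇ-*-prime : ∀ {p e} q → Prime p → ¬ p ∣ e →
                            ι (isPrimeDivisorᵇ q (e * p)) ≡ ι (isPrimeDivisorᵇ q e) + ι (does (q ≟ p))
  isPrimeDivisorᵇ-*-prime {p} {e} q pp np with prime? q
  ... | no ¬pq = sym (cong ι (dec-false (q ≟ p) λ { refl → ¬pq pp }))
  ... | yes pq with q ∣? e | q ∣? (e * p)
  ...   | yes qe | yes _ = sym (cong (λ t → 1 + t) (cong ι (dec-false (q ≟ p) λ { refl → np qe })))
  ...   | yes qe | no nqep = ⊥-elim (nqep (∣m⇒∣m*n p qe))
  ...   | no nqe | no nqep = sym (cong ι (dec-false (q ≟ p) λ { refl → nqep (n∣m*n e) }))
  ...   | no nqe | yes qep with euclidsLemma e p pq qep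
  ...     | inj₁ qe = ⊥-elim (nqe qe)
  ...     | inj₂ qp = sym (cong ι (dec-true (q ≟ p) (prime∣prime⇒≡ pq pp qp)))

  length-primeDivisors-*-prime : ∀ {p e} → Prime p → ¬ p ∣ e → 1 ≤ e →
                                 length (primeDivisors (e * p)) ≡ suc (length (primeDivisors e))
  length-primeDivisors-*-prime {p} {e} pp np e1 = begin
    length (primeDivisors (e * p))
      ≡⟨ length-primeDivisors (e * p) ⟩
    sumℕ (suc (e * p)) (λ q → ι (isPrimeDivisorᵇ q (e * p)))
      ≡⟨ sumℕ-cong (suc (e * p)) (λ q _ → isPrimeDivisorᵇ-*-prime q pp np) ⟩
    sumℕ (suc (e * p)) (λ q → ι (isPrimeDivisorᵇ q e) + ι (does (q ≟ p)))
      ≡⟨ sumℕ-+ (suc (e * p)) _ _ ⟩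
    sumℕ (suc (e * p)) (λ q → ι (isPrimeDivisorᵇ q e)) + sumℕ (suc (e * p)) (λ q → ι (does (q ≟ p)))
      ≡⟨ cong₂ _+_ primeDivisorsOfe onlyp ⟩
    sumℕ (suc e) (λ q → ι (isPrimeDivisorᵇ q e)) + 1
      ≡⟨ cong (_+ 1) (sym (length-primeDivisors e)) ⟩
    length (primeDivisors e) + 1
      ≡⟨ +-comm _ 1 ⟩
    suc (length (primeDivisors e)) ∎
    where
    open ≡-Reasoning
    instance _ = prime⇒nonZero pp
    instance _ = ℕ.>-nonZero e1
    primeDivisorsOfe : sumℕ (suc (e * p)) (λ q → ι (isPrimeDivisorᵇ q e)) ≡ sumℕ (suc e) (λ q → ι (isPrimeDivisorᵇ q e))
    primeDivisorsOfe = sumℕ-shrink (suc e) (suc (e * p)) (s≤s (m≤m*n e p)) λ q e<q _ →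
      cong ι (trans (cong (does (prime? q) ∧_) (dec-false (q ∣? e) (λ q∣e → <⇒≱ e<q (∣⇒≤ q∣e)))) (∧-zeroʳ _))
    onlyp : sumℕ (suc (e * p)) (λ q → ι (does (q ≟ p))) ≡ 1
    onlyp = trans (sumℕ-single (suc (e * p)) p (s≤s (m≤n*m p e)) λ k _ k≢p → cong ι (dec-false (k ≟ p) k≢p))
                  (cong ι (dec-true (p ≟ p) refl))

  μ-unfold : ∀ d → 1 ≤ d → μ d ≡ (if squarefreeᵇ d then -[1+ 0 ] ℤ.^ length (primeDivisors d) else + 0)
  μ-unfold (suc d) _ = refl

  Bool-≡-⇔ : ∀ {a b} → (a ≡ true → b ≡ true) → (b ≡ true → a ≡ true) → a ≡ b
  Bool-≡-⇔ {true} {true} f g = refl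
  Bool-≡-⇔ {false} {false} f g = refl
  Bool-≡-⇔ {true} {false} f g with f refl
  ... | ()
  Bool-≡-⇔ {false} {true} f g with g refl
  ... | ()

  squarefreeᵇ-*-prime : ∀ {p e} → Prime p → ¬ p ∣ e → 1 ≤ e → squarefreeᵇ (e * p) ≡ squarefreeᵇ e
  squarefreeᵇ-*-prime {p} {e} pp np e1 = Bool-≡-⇔
    (λ s → SquareFree⇒squarefreeᵇ e (to (squarefreeᵇ⇒SquareFree (e * p) (*-mono-≤ e1 (prime⇒1≤ pp)) s)))
    (λ s → SquareFree⇒squarefreeᵇ (e * p) (from (squarefreeᵇ⇒SquareFree e e1 s)))
    where
    to : SquareFree (e * p) → SquareFree e
    to h q pq qe qqe = h q pq (∣m⇒∣m*n p qe) (∣m⇒∣m*n p qqe)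
    from : SquareFree e → SquareFree (e * p)
    from h q pq qep qqep with q ≟ p
    ... | yes refl = np (*-cancelʳ-∣ q {{prime⇒nonZero pq}} qqep)
    ... | no q≢p with euclidsLemma e p pq qep
    ...   | inj₂ qp = q≢p (prime∣prime⇒≡ pq pp qp)
    ...   | inj₁ qe = h q pq qe (Cop.coprime-divisor cop (subst (q * q ∣_) (*-comm e p) qqep))
      where
      cop : Cop.Coprime (q * q) p
      cop {i} (iqq , ip) with prime⇒irreducible pp ip
      ... | inj₁ e = e
      ... | inj₂ refl with euclidsLemma q q pp iqq
      ...   | inj₁ pq' = ⊥-elim (q≢p (sym (prime∣prime⇒≡ pp pq pq')))
      ...   | inj₂ pq' = ⊥-elim (q≢p (sym (prime∣prime⇒≡ pp pq pq')))

  μ-*-prime-∤ : ∀ {p e} → Prime p → ¬ p ∣ e → 1 ≤ e → μ (e * p) ≡ ℤ.- μ e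
  μ-*-prime-∤ {p} {e} pp np e1
    rewrite μ-unfold (e * p) (*-mono-≤ e1 (prime⇒1≤ pp)) | μ-unfold e e1
          | squarefreeᵇ-*-prime pp np e1 | length-primeDivisors-*-prime pp np e1
    with squarefreeᵇ e
  ... | true = ℤP.-1*i≡-i _
  ... | false = refl

  μ-*-prime-∣ : ∀ {p e} → Prime p → p ∣ e → 1 ≤ e → μ (e * p) ≡ + 0
  μ-*-prime-∣ {p} {e} pp pe e1 rewrite μ-unfold (e * p) (*-mono-≤ e1 (prime⇒1≤ pp)) with squarefreeᵇ (e * p) in eq
  ... | false = refl
  ... | true = ⊥-elim (squarefreeᵇ⇒SquareFree (e * p) (*-mono-≤ e1 (prime⇒1≤ pp)) eq p pp (n∣m*n e) (*-monoˡ-∣ p pe))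


module MobiusDivisorSum where

  open import Defs using (μ)
  open FiniteSums
  open WordEnumeration using (ιd; ιd-yes; ιd-no)
  open MobiusPrimeFactor
  open import Data.Nat as ℕ using (ℕ; zero; suc; _+_; _*_; _≤_; _<_; z≤n; s≤s)
  open import Data.Nat.Properties
  open import Data.Nat.Divisibility
  import Data.Nat.Coprimality as Cop
  open import Data.Nat.Primality using (Prime; prime⇒irreducible; prime⇒nonZero)
  open import Data.Nat.Primality.Factorisation using (factorise)
  open import Data.Integer as ℤ using (ℤ; +_; -[1+_])
  import Data.Integer.Properties as ℤP
  open import Data.List using (List; []; _∷_)
  import Data.Nat.ListAction
  open import Data.List.Relation.Unary.All using ([]; _∷_)
  open import Data.Product using (_×_; _,_; Σ)
  open import Data.Sum using (inj₁; inj₂)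
  open import Data.Empty using (⊥-elim)
  open import Relation.Nullary using (¬_; Dec; yes; no)
  open import Relation.Nullary.Decidable using (¬?)
  open import Relation.Binary.PropositionalEquality using (_≡_; refl; sym; trans; cong; cong₂; subst; module ≡-Reasoning)

  ιℤ : ∀ {P : Set} → Dec P → ℤ
  ιℤ d = + ιd d

  ιℤ-yes : ∀ {P : Set} (d : Dec P) → P → ιℤ d ≡ + 1
  ιℤ-yes d p = cong +_ (ιd-yes d p)

  ιℤ-no : ∀ {P : Set} (d : Dec P) → ¬ P → ιℤ d ≡ + 0
  ιℤ-no d p = cong +_ (ιd-no d p)

  primeFactor : ∀ N → 2 ≤ N → Σ ℕ λ p → Σ ℕ λ M → Prime p × N ≡ M * p
  primeFactor (suc zero) (s≤s ())
  primeFactor N@(suc (suc _)) _ with factorise N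
  ... | record { factors = [] ; isFactorisation = () }
  ... | record { factors = p ∷ rest ; isFactorisation = e ; factorsPrime = pp ∷ _ } =
    p , Data.Nat.ListAction.product rest , pp , trans e (*-comm p _)

  sumℤ-neg : ∀ n f → sumℤ n (λ k → ℤ.- f k) ≡ ℤ.- sumℤ n f
  sumℤ-neg n f = trans (sumℤ-cong n (λ k _ → sym (ℤP.-1*i≡-i (f k)))) (trans (sumℤ-*ˡ n (ℤ.- + 1) f) (ℤP.-1*i≡-i _))

  sumℤ-multiples : ∀ p M (f : ℕ → ℤ) → 1 ≤ p →
                   sumℤ (M * p) (λ k → ιℤ (p ∣? suc k) ℤ.* f (suc k)) ≡ sumℤ M (λ j → f (suc j * p))
  sumℤ-multiples p zero f _ = refl
  sumℤ-multiples (suc p') (suc M) f _ = begin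
    sumℤ (suc M * p) g                              ≡⟨ cong (λ t → sumℤ t g) (+-comm p (M * p)) ⟩
    sumℤ (M * p + p) g                              ≡⟨ sumℤ-split (M * p) p g ⟩
    sumℤ (M * p) g ℤ.+ sumℤ p (λ i → g (M * p + i)) ≡⟨ cong₂ ℤ._+_ (sumℤ-multiples p M f (s≤s z≤n)) lastBlock ⟩
    sumℤ M (λ j → f (suc j * p)) ℤ.+ f (suc M * p)  ∎
    where
    open ≡-Reasoning
    p = suc p'
    g = λ k → ιℤ (p ∣? suc k) ℤ.* f (suc k)
    suc[Mp+p′]≡[1+M]p : suc (M * p + p') ≡ suc M * p
    suc[Mp+p′]≡[1+M]p = trans (sym (+-suc (M * p) p')) (+-comm (M * p) p)
    lastBlock : sumℤ p (λ i → g (M * p + i)) ≡ f (suc M * p)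
    lastBlock = trans (sumℤ-single p p' ≤-refl λ i i<p ne → cong (ℤ._* f (suc (M * p + i))) (ιℤ-no (p ∣? suc (M * p + i)) λ d →
              ne (≤-antisym (≤-pred i<p) (≤-pred (∣⇒≤ (∣m+n∣m⇒∣n (subst (p ∣_) (sym (+-suc (M * p) i)) d) (n∣m*n M)))))))
             (trans (cong₂ ℤ._*_ (ιℤ-yes (p ∣? suc (M * p + p')) (subst (p ∣_) (sym suc[Mp+p′]≡[1+M]p) (n∣m*n (suc M)))) (cong f suc[Mp+p′]≡[1+M]p))
                    (ℤP.*-identityˡ _))

  ιℤ-⇔ : ∀ {P Q : Set} (d : Dec P) (d' : Dec Q) → (P → Q) → (Q → P) → ιℤ d ≡ ιℤ d'
  ιℤ-⇔ (yes p) d' f g = sym (ιℤ-yes d' (f p))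
  ιℤ-⇔ (no ¬p) d' f g = sym (ιℤ-no d' (λ q → ¬p (g q)))

  ιℤ-split : ∀ {P : Set} (d : Dec P) t → t ≡ ιℤ d ℤ.* t ℤ.+ ιℤ (¬? d) ℤ.* t
  ιℤ-split (yes p) t = sym (trans (ℤP.+-identityʳ _) (ℤP.*-identityˡ t))
  ιℤ-split (no p) t = sym (trans (ℤP.+-identityˡ _) (ℤP.*-identityˡ t))

  ∣*prime⇒∣ : ∀ {p d M} → Prime p → ¬ p ∣ d → d ∣ M * p → d ∣ M
  ∣*prime⇒∣ {p} {d} {M} pp np dMp = Cop.coprime-divisor cop (subst (d ∣_) (*-comm M p) dMp)
    where
    cop : Cop.Coprime d p
    cop {i} (id , ip) with prime⇒irreducible pp ip
    ... | inj₁ e = e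
    ... | inj₂ refl = ⊥-elim (np id)

  *-positive⇒1≤ : ∀ M p {N'} → suc N' ≡ M * p → 1 ≤ M
  *-positive⇒1≤ zero p ()
  *-positive⇒1≤ (suc M) p _ = s≤s z≤n

  -- Divisor sums Σ_{d ∣ N} f d are written Σ_{k < N} [k+1 ∣ N] f (k+1). Split the divisors of N by
  -- divisibility by a prime factor p of N = M p: the multiples dp with p ∤ d carry μ(dp) = −μ(d) and
  -- cancel the divisors of M prime to p, while the rest have μ = 0.
  sum-μ-divisors : ∀ N → 1 ≤ N → sumℤ N (λ k → ιℤ (suc k ∣? N) ℤ.* μ (suc k)) ≡ ιℤ (N ℕ.≟ 1)
  sum-μ-divisors (suc zero) _ = refl
  sum-μ-divisors N@(suc (suc N')) _ with primeFactor N (s≤s (s≤s z≤n))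
  ... | p , M , pp , NMp = begin
    sumℤ N term                ≡⟨ sumℤ-cong N (λ k _ → ιℤ-split (p ∣? suc k) (term k)) ⟩
    sumℤ N (λ k → X k ℤ.+ Y k) ≡⟨ sumℤ-+ N X Y ⟩
    sumℤ N X ℤ.+ sumℤ N Y      ≡⟨ cong₂ ℤ._+_ sumX sumY ⟩
    ℤ.- sumℤ M A ℤ.+ sumℤ M A  ≡⟨ ℤP.+-inverseˡ (sumℤ M A) ⟩
    + 0                        ∎
    where
    open ≡-Reasoning
    instance _ = prime⇒nonZero pp
    term : ℕ → ℤ
    term k = ιℤ (suc k ∣? N) ℤ.* μ (suc k)
    X Y A : ℕ → ℤ
    X k = ιℤ (p ∣? suc k) ℤ.* term k
    Y k = ιℤ (¬? (p ∣? suc k)) ℤ.* term k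
    A k = ιℤ (¬? (p ∣? suc k)) ℤ.* (ιℤ (suc k ∣? M) ℤ.* μ (suc k))
    M≥1 : 1 ≤ M
    M≥1 = *-positive⇒1≤ M p NMp
    sumY : sumℤ N Y ≡ sumℤ M A
    sumY = trans (sumℤ-cong N (λ k _ → split-term k (p ∣? suc k))) (sumℤ-shrink M N (subst (M ≤_) (sym NMp) (m≤m*n M p)) λ k k≥M _ →
             trans (cong (λ t → ιℤ (¬? (p ∣? suc k)) ℤ.* (t ℤ.* μ (suc k)))
                         (ιℤ-no (suc k ∣? M) λ d → <⇒≱ (s≤s k≥M) (∣⇒≤ {{ℕ.>-nonZero M≥1}} d)))
               (ℤP.*-zeroʳ (ιℤ (¬? (p ∣? suc k)))))
      where
      split-term : ∀ k → (d : Dec (p ∣ suc k)) →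
           ιℤ (¬? d) ℤ.* (ιℤ (suc k ∣? N) ℤ.* μ (suc k)) ≡ ιℤ (¬? d) ℤ.* (ιℤ (suc k ∣? M) ℤ.* μ (suc k))
      split-term k (yes _) = refl
      split-term k (no np) = cong (λ t → + 1 ℤ.* (t ℤ.* μ (suc k))) (ιℤ-⇔ (suc k ∣? N) (suc k ∣? M)
        (λ d → ∣*prime⇒∣ pp np (subst (suc k ∣_) NMp d)) (λ d → subst (suc k ∣_) (sym NMp) (∣m⇒∣m*n p d)))
    sumX : sumℤ N X ≡ ℤ.- sumℤ M A
    sumX = trans (cong (λ t → sumℤ t X) NMp) (trans (sumℤ-multiples p M (λ d → ιℤ (d ∣? N) ℤ.* μ d) (prime⇒1≤ pp))
            (trans (sumℤ-cong M (λ j _ → split-term j (p ∣? suc j))) (sumℤ-neg M A)))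
      where
      split-term : ∀ j → (d : Dec (p ∣ suc j)) →
           ιℤ (suc j * p ∣? N) ℤ.* μ (suc j * p) ≡ ℤ.- (ιℤ (¬? d) ℤ.* (ιℤ (suc j ∣? M) ℤ.* μ (suc j)))
      split-term j (yes pd) = trans (cong (ιℤ (suc j * p ∣? N) ℤ.*_) (μ-*-prime-∣ pp pd (s≤s z≤n))) (ℤP.*-zeroʳ (ιℤ (suc j * p ∣? N)))
      split-term j (no np) = trans (cong₂ ℤ._*_ (ιℤ-⇔ (suc j * p ∣? N) (suc j ∣? M) (λ d → *-cancelʳ-∣ p (subst (suc j * p ∣_) NMp d))
                            (λ d → subst (suc j * p ∣_) (sym NMp) (*-monoˡ-∣ p d))) (μ-*-prime-∤ pp np (s≤s z≤n)))
        (trans (sym (ℤP.neg-distribʳ-* (ιℤ (suc j ∣? M)) (μ (suc j)))) (cong ℤ.-_ (sym (ℤP.*-identityˡ _))))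


module MobiusInversion where

  open import Defs using (μ)
  open FiniteSums
  open MobiusDivisorSum
  open import Data.Nat as ℕ using (ℕ; zero; suc; _+_; _*_; _≤_; _<_; z≤n; s≤s; NonZero; _/_)
  open import Data.Nat.Properties
  open import Data.Nat.Divisibility
  open import Data.Nat.DivMod using (m/n*n≡m; n/n≡1; m/n≤m)
  open import Data.Integer as ℤ using (ℤ; +_)
  import Data.Integer.Properties as ℤP
  open import Data.Integer.Tactic.RingSolver using (solve-∀)
  open import Data.Empty using (⊥-elim)
  open import Relation.Nullary using (Dec; yes; no)
  open import Relation.Binary.PropositionalEquality using (_≡_; _≢_; refl; sym; trans; cong; cong₂; subst; module ≡-Reasoning)

  ιℤ-*-cong : ∀ {P : Set} (d : Dec P) {Y Y' : ℤ} → (P → Y ≡ Y') → ιℤ d ℤ.* Y ≡ ιℤ d ℤ.* Y'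
  ιℤ-*-cong (yes p) f = cong (+ 1 ℤ.*_) (f p)
  ιℤ-*-cong (no _) f = refl

  ιℤ-∣-∣/ : ∀ a b n .{{_ : NonZero a}} → ιℤ (a ∣? n) ℤ.* ιℤ (b ∣? n / a) ≡ ιℤ (a * b ∣? n)
  ιℤ-∣-∣/ a b n with a ∣? n
  ... | no na = sym (ιℤ-no (a * b ∣? n) λ abn → na (m*n∣⇒m∣ a b abn))
  ... | yes an = trans (ℤP.*-identityˡ _)
    (ιℤ-⇔ (b ∣? n / a) (a * b ∣? n) (λ d → subst (_∣ n) (*-comm b a) (m∣n/o⇒m*o∣n an d)) (m*n∣o⇒n∣o/m a b))

  /-positive : ∀ {a n} .{{_ : NonZero a}} → a ∣ n → 1 ≤ n → 1 ≤ n / a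
  /-positive {a} {n} an n1 with n / a in eq
  ... | zero = ⊥-elim (<⇒≢ n1 (sym (trans (sym (m/n*n≡m an)) (cong (_* a) eq))))
  ... | suc _ = s≤s z≤n

  /≡1⇒≡ : ∀ {b n} .{{_ : NonZero b}} → b ∣ n → n / b ≡ 1 → b ≡ n
  /≡1⇒≡ {b} {n} bn e = trans (sym (+-identityʳ b)) (trans (cong (_* b) (sym e)) (m/n*n≡m bn))

  -- [a ∣ n] [b ∣ n/a] = [ab ∣ n] is symmetric in a and b.
  ιℤ-∣-∣/-swap : ∀ a b n .{{_ : NonZero a}} .{{_ : NonZero b}} →
                 ιℤ (a ∣? n) ℤ.* ιℤ (b ∣? n / a) ≡ ιℤ (b ∣? n) ℤ.* ιℤ (a ∣? n / b)
  ιℤ-∣-∣/-swap a b n = trans (ιℤ-∣-∣/ a b n) (trans (cong (λ t → ιℤ (t ∣? n)) (*-comm a b)) (sym (ιℤ-∣-∣/ b a n)))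

  *-interchange-via : ∀ A B C D → A ℤ.* B ≡ C ℤ.* D → ∀ M H → (A ℤ.* M) ℤ.* (B ℤ.* H) ≡ (C ℤ.* H) ℤ.* (D ℤ.* M)
  *-interchange-via A B C D e M H = trans (regroup₁ A B M H) (trans (cong (ℤ._* (M ℤ.* H)) e) (regroup₂ C D M H))
    where
    regroup₁ : ∀ A B M H → (A ℤ.* M) ℤ.* (B ℤ.* H) ≡ (A ℤ.* B) ℤ.* (M ℤ.* H)
    regroup₁ = solve-∀
    regroup₂ : ∀ C D M H → (C ℤ.* D) ℤ.* (M ℤ.* H) ≡ (C ℤ.* H) ℤ.* (D ℤ.* M)
    regroup₂ = solve-∀

  ιℤ-*-*-zero : ∀ {P : Set} (d : Dec P) X Y → (P → Y ≡ + 0) → (ιℤ d ℤ.* X) ℤ.* Y ≡ + 0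
  ιℤ-*-*-zero (yes p) X Y f = trans (cong ((+ 1 ℤ.* X) ℤ.*_) (f p)) (ℤP.*-zeroʳ (+ 1 ℤ.* X))
  ιℤ-*-*-zero (no _) X Y f = refl

  module Inversion (g h : ℕ → ℤ)
    (g≡∑h : ∀ N → 1 ≤ N → g N ≡ sumℤ N (λ j → ιℤ (suc j ∣? N) ℤ.* h (suc j))) where

    g≡∑h-padded : ∀ N n → 1 ≤ N → N ≤ n → g N ≡ sumℤ n (λ j → ιℤ (suc j ∣? N) ℤ.* h (suc j))
    g≡∑h-padded N n N1 le = trans (g≡∑h N N1) (sym (sumℤ-shrink N n le λ j j≥N _ →
       cong (ℤ._* h (suc j)) (ιℤ-no (suc j ∣? N) λ d → <⇒≱ (s≤s j≥N) (∣⇒≤ {{ℕ.>-nonZero N1}} d))))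

    sum-μ-divisors-padded : ∀ N n → 1 ≤ N → N ≤ n → sumℤ n (λ k → ιℤ (suc k ∣? N) ℤ.* μ (suc k)) ≡ ιℤ (N ℕ.≟ 1)
    sum-μ-divisors-padded N n N1 le = trans (sumℤ-shrink N n le λ k k≥N _ →
       cong (ℤ._* μ (suc k)) (ιℤ-no (suc k ∣? N) λ d → <⇒≱ (s≤s k≥N) (∣⇒≤ {{ℕ.>-nonZero N1}} d))) (sum-μ-divisors N N1)

    mobiusInversion : ∀ m → sumℤ (suc m) (λ k → ιℤ (suc k ∣? suc m) ℤ.* (μ (suc k) ℤ.* g (suc m / suc k))) ≡ h (suc m)
    mobiusInversion m = begin
      sumℤ n (λ k → ιℤ (suc k ∣? n) ℤ.* (μ (suc k) ℤ.* g (n / suc k)))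
        ≡⟨ sumℤ-cong n (λ k _ → expand k) ⟩
      sumℤ n (λ k → sumℤ n (λ j → F k j))
        ≡⟨ sumℤ-swap n n F ⟩
      sumℤ n (λ j → sumℤ n (λ k → F k j))
        ≡⟨ sumℤ-cong n (λ j _ → regroup j) ⟩
      sumℤ n (λ j → (ιℤ (suc j ∣? n) ℤ.* h (suc j)) ℤ.* sumℤ n (λ k → ιℤ (suc k ∣? n / suc j) ℤ.* μ (suc k)))
        ≡⟨ sumℤ-cong n (λ j _ → innerMobiusSum j) ⟩
      sumℤ n (λ j → (ιℤ (suc j ∣? n) ℤ.* h (suc j)) ℤ.* ιℤ (n / suc j ℕ.≟ 1))
        ≡⟨ sumℤ-single n m ≤-refl (λ j _ ne → offDiagonal j ne) ⟩
      (ιℤ (n ∣? n) ℤ.* h n) ℤ.* ιℤ (n / n ℕ.≟ 1)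
        ≡⟨ cong₂ (λ x y → (x ℤ.* h n) ℤ.* y) (ιℤ-yes (n ∣? n) ∣-refl) (ιℤ-yes (n / n ℕ.≟ 1) (n/n≡1 n)) ⟩
      (+ 1 ℤ.* h n) ℤ.* + 1
        ≡⟨ trans (ℤP.*-identityʳ _) (ℤP.*-identityˡ _) ⟩
      h n ∎
      where
      open ≡-Reasoning
      n = suc m
      F : ℕ → ℕ → ℤ
      F k j = (ιℤ (suc k ∣? n) ℤ.* μ (suc k)) ℤ.* (ιℤ (suc j ∣? n / suc k) ℤ.* h (suc j))
      expand : ∀ k → ιℤ (suc k ∣? n) ℤ.* (μ (suc k) ℤ.* g (n / suc k)) ≡ sumℤ n (λ j → F k j)
      expand k = trans (ιℤ-*-cong (suc k ∣? n) (λ d → cong (μ (suc k) ℤ.*_)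
                                                 (g≡∑h-padded (n / suc k) n (/-positive d (s≤s z≤n)) (m/n≤m n (suc k)))))
        (trans (sym (ℤP.*-assoc (ιℤ (suc k ∣? n)) (μ (suc k)) _))
               (sym (sumℤ-*ˡ n (ιℤ (suc k ∣? n) ℤ.* μ (suc k)) (λ j → ιℤ (suc j ∣? n / suc k) ℤ.* h (suc j)))))
      regroup : ∀ j → sumℤ n (λ k → F k j) ≡
                      (ιℤ (suc j ∣? n) ℤ.* h (suc j)) ℤ.* sumℤ n (λ k → ιℤ (suc k ∣? n / suc j) ℤ.* μ (suc k))
      regroup j = trans (sumℤ-cong n (λ k _ → *-interchange-via (ιℤ (suc k ∣? n)) (ιℤ (suc j ∣? n / suc k))
                                                                (ιℤ (suc j ∣? n)) (ιℤ (suc k ∣? n / suc j))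
                                                (ιℤ-∣-∣/-swap (suc k) (suc j) n) (μ (suc k)) (h (suc j))))
        (sumℤ-*ˡ n (ιℤ (suc j ∣? n) ℤ.* h (suc j)) (λ k → ιℤ (suc k ∣? n / suc j) ℤ.* μ (suc k)))
      innerMobiusSum : ∀ j → (ιℤ (suc j ∣? n) ℤ.* h (suc j)) ℤ.* sumℤ n (λ k → ιℤ (suc k ∣? n / suc j) ℤ.* μ (suc k)) ≡
                             (ιℤ (suc j ∣? n) ℤ.* h (suc j)) ℤ.* ιℤ (n / suc j ℕ.≟ 1)
      innerMobiusSum j = trans (ℤP.*-assoc C H _)
        (trans (ιℤ-*-cong (suc j ∣? n) (λ d → cong (H ℤ.*_)
                 (sum-μ-divisors-padded (n / suc j) n (/-positive d (s≤s z≤n)) (m/n≤m n (suc j)))))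
               (sym (ℤP.*-assoc C H (ιℤ (n / suc j ℕ.≟ 1)))))
        where
        C = ιℤ (suc j ∣? n)
        H = h (suc j)
      offDiagonal : ∀ j → j ≢ m → (ιℤ (suc j ∣? n) ℤ.* h (suc j)) ℤ.* ιℤ (n / suc j ℕ.≟ 1) ≡ + 0
      offDiagonal j ne = ιℤ-*-*-zero (suc j ∣? n) (h (suc j)) _ λ d →
        ιℤ-no (n / suc j ℕ.≟ 1) λ e → ne (suc-injective (/≡1⇒≡ d e))

module LucasInZφ where

  open import Defs
  open FiniteSums
  open WordEnumeration using (ι)
  open AdmissibleWords using (fib; lucas)
  open import Data.Bool using (Bool; true; false)
  open import Data.Nat as ℕ using (ℕ; zero; suc)
  open import Data.Nat.Properties using (+-comm)
  open import Data.Nat.Divisibility using (_∣?_)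
  open import Data.Integer as ℤ using (ℤ; +_)
  import Data.Integer.Properties as ℤP
  open import Data.Integer.Tactic.RingSolver using (solve-∀)
  open import Data.List using (map; filterᵇ; applyUpTo; foldr)
  open import Function using (_∘_)
  open import Relation.Nullary using (does)
  open import Relation.Binary.PropositionalEquality using (_≡_; refl; sym; trans; cong; cong₂)

  φ^suc-fib : ∀ k → φ ^φ suc k ≡ (+ fib k) + (+ fib (suc k)) φ
  φ^suc-fib zero = refl
  φ^suc-fib (suc k) = trans (cong (φ ⊗_) (φ^suc-fib k))
    (cong₂ _+_φ (re-identity (+ fib k) (+ fib (suc k))) (trans (im-identity (+ fib k) (+ fib (suc k))) (sym (ℤP.pos-+ (fib (suc k)) (fib k)))))
    where
    re-identity : ∀ a b → + 0 ℤ.* a ℤ.+ + 1 ℤ.* b ≡ b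
    re-identity = solve-∀
    im-identity : ∀ a b → + 0 ℤ.* b ℤ.+ + 1 ℤ.* a ℤ.+ + 1 ℤ.* b ≡ b ℤ.+ a
    im-identity = solve-∀

  ψ^-fib : ∀ k → ψ ^φ k ≡ (+ fib (suc k)) + (ℤ.- (+ fib k)) φ
  ψ^-fib zero = refl
  ψ^-fib (suc k) = trans (cong (ψ ⊗_) (ψ^-fib k)) (cong₂ _+_φ (trans (re-identity (+ fib (suc k)) (+ fib k)) (sym (ℤP.pos-+ (fib (suc k)) (fib k))))
     (im-identity (+ fib (suc k)) (+ fib k)))
    where
    re-identity : ∀ a b → + 1 ℤ.* a ℤ.+ (ℤ.- + 1) ℤ.* (ℤ.- b) ≡ a ℤ.+ b
    re-identity = solve-∀
    im-identity : ∀ a b → + 1 ℤ.* (ℤ.- b) ℤ.+ (ℤ.- + 1) ℤ.* a ℤ.+ (ℤ.- + 1) ℤ.* (ℤ.- b) ≡ ℤ.- a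
    im-identity = solve-∀

  φ^+ψ^≡lucas : ∀ k → (φ ^φ k) ⊕ (ψ ^φ k) ≡ embed (+ lucas k)
  φ^+ψ^≡lucas zero = refl
  φ^+ψ^≡lucas (suc k) = trans (cong₂ _⊕_ (φ^suc-fib k) (ψ^-fib (suc k)))
    (cong₂ _+_φ (trans (sym (ℤP.pos-+ (fib k) (fib (suc (suc k))))) (cong +_ (+-comm (fib k) _))) (ℤP.+-inverseʳ (+ fib (suc k))))

  embed-⊗ : ∀ a b → embed a ⊗ embed b ≡ embed (a ℤ.* b)
  embed-⊗ a b = cong₂ _+_φ (re-identity a b) (im-identity a b)
    where
    re-identity : ∀ a b → a ℤ.* b ℤ.+ + 0 ℤ.* + 0 ≡ a ℤ.* b
    re-identity = solve-∀
    im-identity : ∀ a b → a ℤ.* + 0 ℤ.+ + 0 ℤ.* b ℤ.+ + 0 ℤ.* + 0 ≡ + 0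
    im-identity = solve-∀

  foldr-⊕-filterᵇ≡embed-sumℤ : ∀ K (f : ℕ → ℕ) (P : ℕ → Bool) (g : ℕ → ℤφ) (t : ℕ → ℤ) →
    (∀ x → g x ≡ embed (t x)) →
    foldr _⊕_ 0φ (map g (filterᵇ P (applyUpTo f K))) ≡ embed (sumℤ K (λ q → + ι (P (f q)) ℤ.* t (f q)))
  foldr-⊕-filterᵇ≡embed-sumℤ zero f P g t e = refl
  foldr-⊕-filterᵇ≡embed-sumℤ (suc K) f P g t e with P (f 0) in eq
  ... | true = trans (cong₂ _⊕_ (e (f 0)) (foldr-⊕-filterᵇ≡embed-sumℤ K (f ∘ suc) P g t e)) (cong embed (sym (trans (sumℤ-suc K _)
        (cong₂ ℤ._+_ (trans (cong (λ b → + ι b ℤ.* t (f 0)) eq) (ℤP.*-identityˡ _)) refl))))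
  ... | false = trans (foldr-⊕-filterᵇ≡embed-sumℤ K (f ∘ suc) P g t e) (cong embed (sym (trans (sumℤ-suc K _)
        (trans (cong (λ b → (+ ι b ℤ.* t (f 0)) ℤ.+ sumℤ K (λ q → + ι (P (f (suc q))) ℤ.* t (f (suc q)))) eq) (ℤP.+-identityˡ _)))))

  mobiusSum≡embed-sumℤ : ∀ n →
    mobiusSum n ≡ embed (sumℤ n (λ k → + ι (does (suc k ∣? n)) ℤ.* (μ (suc k) ℤ.* + lucas (n ℕ./ suc k))))
  mobiusSum≡embed-sumℤ n = foldr-⊕-filterᵇ≡embed-sumℤ n (λ x → x) _ _ _ λ k →
    trans (cong (embed (μ (suc k)) ⊗_) (φ^+ψ^≡lucas (n ℕ./ suc k))) (embed-⊗ (μ (suc k)) (+ lucas (n ℕ./ suc k)))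


-- The two estimates behind |x| < y in ZφOrder.AbsLtBound, in the variables used there.
module NatSquareBounds where

  open import Data.Nat as ℕ using (ℕ; suc; _+_; _*_; _≤_; _<_)
  open import Data.Nat.Properties
  open import Data.Nat.Tactic.RingSolver using (solve-∀)
  open import Relation.Binary.PropositionalEquality using (_≡_; sym)
  open import Data.Product using (_×_; _,_)

  square-mono-≤ : ∀ {x y} → x ≤ y → x * x ≤ y * y
  square-mono-≤ le = *-mono-≤ le le

  square-mono-< : ∀ {x y} → x < y → x * x < y * y
  square-mono-< lt = *-mono-< lt lt

  w+2pL≤[p+q]L : ∀ p q L m w → m ≤ L → w + (p + q) * L ≡ 2 * q * m → w + 2 * p * L ≤ (p + q) * L
  w+2pL≤[p+q]L p q L m w m≤L e = begin
    w + 2 * p * L        ≡⟨ identity₁ w p L ⟩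
    (w + p * L) + p * L  ≤⟨ +-monoˡ-≤ (p * L) (+-cancelʳ-≤ (q * L) (w + p * L) (q * L) w+pL+qL≤2qL) ⟩
    q * L + p * L        ≡⟨ identity₂ p q L ⟩
    (p + q) * L          ∎
    where
    open ≤-Reasoning
    identity₁ : ∀ w p L → w + 2 * p * L ≡ (w + p * L) + p * L
    identity₁ = solve-∀
    identity₂ : ∀ p q L → q * L + p * L ≡ (p + q) * L
    identity₂ = solve-∀
    identity₃ : ∀ w p q L → (w + p * L) + q * L ≡ w + (p + q) * L
    identity₃ = solve-∀
    identity₄ : ∀ q L → 2 * q * L ≡ q * L + q * L
    identity₄ = solve-∀
    w+pL+qL≤2qL : (w + p * L) + q * L ≤ q * L + q * L
    w+pL+qL≤2qL = begin
      (w + p * L) + q * L ≡⟨ identity₃ w p q L ⟩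
      w + (p + q) * L     ≡⟨ e ⟩
      2 * q * m           ≤⟨ *-monoʳ-≤ (2 * q) m≤L ⟩
      2 * q * L           ≡⟨ identity₄ q L ⟩
      q * L + q * L       ∎

  w²+4L²≤[w+2pL]² : ∀ p L w → 1 ≤ p → w * w + 4 * (L * L) ≤ (w + 2 * p * L) * (w + 2 * p * L)
  w²+4L²≤[w+2pL]² p L w p≥1 = begin
    w * w + 4 * (L * L)                               ≤⟨ +-monoʳ-≤ (w * w) (*-monoʳ-≤ 4 (square-mono-≤ (m≤n*m L p {{ℕ.>-nonZero p≥1}}))) ⟩
    w * w + 4 * ((p * L) * (p * L))                   ≤⟨ +-monoʳ-≤ (w * w) (m≤n+m _ (4 * p * L * w)) ⟩
    w * w + (4 * p * L * w + 4 * ((p * L) * (p * L))) ≡⟨ identity w p L ⟩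
    (w + 2 * p * L) * (w + 2 * p * L)                 ∎
    where
    open ≤-Reasoning
    identity : ∀ w p L → w * w + (4 * p * L * w + 4 * ((p * L) * (p * L))) ≡ (w + 2 * p * L) * (w + 2 * p * L)
    identity = solve-∀

  squareBound-y-x : ∀ p q L b m w → 1 ≤ p → m ≤ L → suc (p + q) ≤ L → L * L ≤ 5 * (b * b) + 4 →
                    w + (p + q) * L ≡ 2 * q * m → w * w < 5 * (((p + q) * b) * ((p + q) * b))
  squareBound-y-x p q L b m w p≥1 m≤L p+q<L cassini e =
    +-cancelʳ-< (4 * (L * L)) (w * w) (5 * ((s * b) * (s * b))) (begin-strict
      w * w + 4 * (L * L)                   ≤⟨ w²+4L²≤[w+2pL]² p L w p≥1 ⟩
      (w + 2 * p * L) * (w + 2 * p * L)     ≤⟨ square-mono-≤ (w+2pL≤[p+q]L p q L m w m≤L e) ⟩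
      (s * L) * (s * L)                     ≡⟨ identity₁ s L ⟩
      (s * s) * (L * L)                     ≤⟨ *-monoʳ-≤ (s * s) cassini ⟩
      (s * s) * (5 * (b * b) + 4)           ≡⟨ identity₂ s b ⟩
      5 * ((s * b) * (s * b)) + 4 * (s * s) <⟨ +-monoʳ-< (5 * ((s * b) * (s * b))) (*-monoʳ-< 4 (square-mono-< p+q<L)) ⟩
      5 * ((s * b) * (s * b)) + 4 * (L * L) ∎)
    where
    open ≤-Reasoning
    s = p + q
    identity₁ : ∀ s L → (s * L) * (s * L) ≡ (s * s) * (L * L)
    identity₁ = solve-∀
    identity₂ : ∀ s b → (s * s) * (5 * (b * b) + 4) ≡ 5 * ((s * b) * (s * b)) + 4 * (s * s)
    identity₂ = solve-∀

  tL+t≤v : ∀ p t L D v → 1 ≤ p → (2 * D + 1) * (p + t) ≤ L → v + 2 * (p + t) * D ≡ (p + (p + t)) * L → t * L + t ≤ v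
  tL+t≤v p t L D v p≥1 D-small e = +-cancelʳ-≤ (2 * q * D) (t * L + t) v (begin
    (t * L + t) + 2 * q * D ≡⟨ identity₁ t L (2 * q * D) ⟩
    t * L + (2 * q * D + t) ≤⟨ +-monoʳ-≤ (t * L) 2qD+t≤2pL ⟩
    t * L + 2 * p * L       ≡⟨ identity₂ p t L ⟩
    (p + q) * L             ≡⟨ sym e ⟩
    v + 2 * q * D           ∎)
    where
    open ≤-Reasoning
    q = p + t
    identity₀ : ∀ q D → (2 * q * D + q) + (2 * q * D + q) ≡ 2 * ((2 * D + 1) * q)
    identity₀ = solve-∀
    identity₁ : ∀ t L X → (t * L + t) + X ≡ t * L + (X + t)
    identity₁ = solve-∀
    identity₂ : ∀ p t L → t * L + 2 * p * L ≡ (p + (p + t)) * L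
    identity₂ = solve-∀
    2qD+t≤2pL : 2 * q * D + t ≤ 2 * p * L
    2qD+t≤2pL = begin
      2 * q * D + t                     ≤⟨ +-monoʳ-≤ (2 * q * D) (m≤n+m t p) ⟩
      2 * q * D + q                     ≤⟨ m≤m+n _ (2 * q * D + q) ⟩
      (2 * q * D + q) + (2 * q * D + q) ≡⟨ identity₀ q D ⟩
      2 * ((2 * D + 1) * q)             ≤⟨ *-monoʳ-≤ 2 D-small ⟩
      2 * L                             ≤⟨ *-monoˡ-≤ L (*-monoʳ-≤ 2 p≥1) ⟩
      2 * p * L                         ∎

  squareBound-y+x : ∀ p t L b D v → 1 ≤ p → 1 ≤ t → 2 ≤ L → 5 * (b * b) ≤ L * L + 4 → (2 * D + 1) * (p + t) ≤ L →
                    v + 2 * (p + t) * D ≡ (p + (p + t)) * L → (t * L + t ≤ v) × (5 * ((t * b) * (t * b)) < v * v)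
  squareBound-y+x p t L b D v p≥1 t≥1 L≥2 cassini D-small e = tL+t≤v′ , (begin-strict
    5 * ((t * b) * (t * b))         ≡⟨ identity₁ t b ⟩
    (t * t) * (5 * (b * b))         ≤⟨ *-monoʳ-≤ (t * t) cassini ⟩
    (t * t) * (L * L + 4)           <⟨ *-monoʳ-< (t * t) {{ℕ.>-nonZero (*-mono-≤ t≥1 t≥1)}} (+-monoʳ-< (L * L) 4<2L+1) ⟩
    (t * t) * (L * L + (2 * L + 1)) ≡⟨ identity₂ t L ⟩
    (t * L + t) * (t * L + t)       ≤⟨ square-mono-≤ tL+t≤v′ ⟩
    v * v                           ∎)
    where
    open ≤-Reasoning
    tL+t≤v′ = tL+t≤v p t L D v p≥1 D-small e
    4<2L+1 : 4 < 2 * L + 1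
    4<2L+1 = +-monoˡ-≤ 1 (*-monoʳ-≤ 2 L≥2)
    identity₁ : ∀ t b → 5 * ((t * b) * (t * b)) ≡ (t * t) * (5 * (b * b))
    identity₁ = solve-∀
    identity₂ : ∀ t L → (t * t) * (L * L + (2 * L + 1)) ≡ (t * L + t) * (t * L + t)
    identity₂ = solve-∀


module ZφOrder where

  open import Defs
  open NatSquareBounds
  open import Data.Nat as ℕ using (ℕ; zero; suc; _+_; _*_; _≤_; _<_; z≤n; s≤s)
  open import Data.Nat.Properties as ℕP using (m≤n⇒∃[o]m+o≡n; ≤-trans; m≤m+n; m≤n+m; +-comm)
  import Data.Nat.Tactic.RingSolver as NS
  open import Data.Integer as ℤ using (ℤ; +_; -[1+_]; +<+; -<+; +≤+)
  import Data.Integer.Properties as ℤP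
  open import Data.Integer.Tactic.RingSolver using (solve-∀)
  open import Data.Product using (_,_; Σ)
  open import Data.Empty using (⊥-elim)
  open import Relation.Nullary using (yes; no)
  open import Relation.Binary.PropositionalEquality using (_≡_; refl; sym; trans; cong; cong₂; subst; subst₂)

  positive-pos-nonneg : ∀ {r i} x y → (+ 2) ℤ.* r ℤ.+ i ≡ + suc x → i ≡ + y → Positive (_+_φ r i)
  positive-pos-nonneg x y ex ei = pos₁ (subst (ℤ.0ℤ ℤ.<_) (sym ex) (+<+ (s≤s z≤n))) (subst (ℤ.0ℤ ℤ.≤_) (sym ei) (+≤+ z≤n))

  positive-nonneg-pos : ∀ {r i} x y → (+ 2) ℤ.* r ℤ.+ i ≡ + x → i ≡ + suc y → Positive (_+_φ r i)
  positive-nonneg-pos x y ex ei = pos₂ (subst (ℤ.0ℤ ℤ.≤_) (sym ex) (+≤+ z≤n)) (subst (ℤ.0ℤ ℤ.<_) (sym ei) (+<+ (s≤s z≤n)))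

  positive-pos-neg : ∀ {r i} x u → (+ 2) ℤ.* r ℤ.+ i ≡ + suc x → i ≡ -[1+ u ] →
                     5 * (suc u * suc u) < suc x * suc x → Positive (_+_φ r i)
  positive-pos-neg x u ex ei lt = pos₃ (subst (ℤ.0ℤ ℤ.<_) (sym ex) (+<+ (s≤s z≤n))) (subst (ℤ._< ℤ.0ℤ) (sym ei) -<+)
    (subst₂ ℤ._<_ (cong (λ t → + 5 ℤ.* (t ℤ.* t)) (sym ei)) (cong (λ t → t ℤ.* t) (sym ex)) (+<+ lt))

  positive-neg-pos : ∀ {r i} u y → (+ 2) ℤ.* r ℤ.+ i ≡ -[1+ u ] → i ≡ + suc y →
                     suc u * suc u < 5 * (suc y * suc y) → Positive (_+_φ r i)
  positive-neg-pos u y ex ei lt = pos₄ (subst (ℤ._< ℤ.0ℤ) (sym ex) -<+) (subst (ℤ.0ℤ ℤ.<_) (sym ei) (+<+ (s≤s z≤n)))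
    (subst₂ ℤ._<_ (cong (λ t → t ℤ.* t) (sym ex)) (cong (λ t → + 5 ℤ.* (t ℤ.* t)) (sym ei)) (+<+ lt))

  +≡⇒-≡ : ∀ a b c → a ℤ.+ b ≡ c → c ℤ.- a ≡ b
  +≡⇒-≡ a b c e = trans (cong (ℤ._- a) (sym e)) (identity a b)
    where
    identity : ∀ a b → (a ℤ.+ b) ℤ.- a ≡ b
    identity = solve-∀

  +≡⇒-≡- : ∀ a b c → a ℤ.+ b ≡ c → a ℤ.- c ≡ ℤ.- b
  +≡⇒-≡- a b c e = trans (cong (λ t → a ℤ.- t) (sym e)) (identity a b)
    where
    identity : ∀ a b → a ℤ.- (a ℤ.+ b) ≡ ℤ.- b
    identity = solve-∀

  ≡⇒-≡0 : ∀ a b → a ≡ b → a ℤ.- b ≡ + 0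
  ≡⇒-≡0 a b refl = ℤP.+-inverseʳ a

  positive-suc : ∀ n → 1 ≤ n → Σ ℕ λ k → n ≡ suc k
  positive-suc (suc k) _ = k , refl

  -- For L = 2a + b we have a + bφ = (L + b√5)/2, and by Cassini's identity L² − 5b² = ±4. With
  -- x = q (m − (a + bφ)) and y = p (a + bφ), each of y − x and y + x has coordinates computed by a
  -- ring identity, and its positivity reduces to the natural-number inequalities of NatSquareBounds.
  module AbsLtBound (p q a b m D : ℕ) (p≥1 : 1 ≤ p) (q≥1 : 1 ≤ q) (b≥1 : 1 ≤ b)
    (m+D≡L : m + D ≡ 2 * a + b)
    (L²≤5b²+4 : (2 * a + b) * (2 * a + b) ≤ 5 * (b * b) + 4)
    (5b²≤L²+4 : 5 * (b * b) ≤ (2 * a + b) * (2 * a + b) + 4)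
    (p+q<L : suc (p + q) ≤ 2 * a + b)
    (D-small : (2 * D + 1) * q ≤ 2 * a + b) where

    L = 2 * a + b
    P Q A B M L' : ℤ
    P = + p
    Q = + q
    A = + a
    B = + b
    M = + m
    L' = (+ 2) ℤ.* A ℤ.+ B

    +L : + L ≡ L'
    +L = trans (ℤP.pos-+ (2 * a) b) (cong (ℤ._+ B) (ℤP.pos-* 2 a))

    +[p+q]L : + ((p + q) * L) ≡ (P ℤ.+ Q) ℤ.* L'
    +[p+q]L = trans (ℤP.pos-* (p + q) L) (cong₂ ℤ._*_ (ℤP.pos-+ p q) +L)

    +2qm : + (2 * q * m) ≡ (+ 2) ℤ.* Q ℤ.* M
    +2qm = trans (ℤP.pos-* (2 * q) m) (cong (ℤ._* M) (ℤP.pos-* 2 q))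

    x y : ℤφ
    x = embed Q ⊗ (embed M ⊖ (_+_φ A B))
    y = embed P ⊗ (_+_φ A B)

    -- The coordinates of y − x and of y + x, as they unfold definitionally.
    R₋ I₋ R₊ I₊ : ℤ
    R₋ = (P ℤ.* A ℤ.+ + 0 ℤ.* B) ℤ.- (Q ℤ.* (M ℤ.- A) ℤ.+ + 0 ℤ.* (+ 0 ℤ.- B))
    I₋ = (P ℤ.* B ℤ.+ + 0 ℤ.* A ℤ.+ + 0 ℤ.* B) ℤ.- (Q ℤ.* (+ 0 ℤ.- B) ℤ.+ + 0 ℤ.* (M ℤ.- A) ℤ.+ + 0 ℤ.* (+ 0 ℤ.- B))
    R₊ = (P ℤ.* A ℤ.+ + 0 ℤ.* B) ℤ.- (+ 0 ℤ.- (Q ℤ.* (M ℤ.- A) ℤ.+ + 0 ℤ.* (+ 0 ℤ.- B)))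
    I₊ = (P ℤ.* B ℤ.+ + 0 ℤ.* A ℤ.+ + 0 ℤ.* B) ℤ.- (+ 0 ℤ.- (Q ℤ.* (+ 0 ℤ.- B) ℤ.+ + 0 ℤ.* (M ℤ.- A) ℤ.+ + 0 ℤ.* (+ 0 ℤ.- B)))

    2R₋+I₋ : (+ 2) ℤ.* R₋ ℤ.+ I₋ ≡ (P ℤ.+ Q) ℤ.* L' ℤ.- (+ 2) ℤ.* Q ℤ.* M
    2R₋+I₋ = identity P Q A B M
      where
      identity : ∀ P Q A B M → (+ 2) ℤ.* ((P ℤ.* A ℤ.+ + 0 ℤ.* B) ℤ.- (Q ℤ.* (M ℤ.- A) ℤ.+ + 0 ℤ.* (+ 0 ℤ.- B)))
        ℤ.+ ((P ℤ.* B ℤ.+ + 0 ℤ.* A ℤ.+ + 0 ℤ.* B) ℤ.- (Q ℤ.* (+ 0 ℤ.- B) ℤ.+ + 0 ℤ.* (M ℤ.- A) ℤ.+ + 0 ℤ.* (+ 0 ℤ.- B)))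
        ≡ (P ℤ.+ Q) ℤ.* ((+ 2) ℤ.* A ℤ.+ B) ℤ.- (+ 2) ℤ.* Q ℤ.* M
      identity = solve-∀

    I₋≡ : I₋ ≡ + ((p + q) * b)
    I₋≡ = trans (identity P Q A B M) (sym (trans (ℤP.pos-* (p + q) b) (cong (ℤ._* B) (ℤP.pos-+ p q))))
      where
      identity : ∀ P Q A B M → (P ℤ.* B ℤ.+ + 0 ℤ.* A ℤ.+ + 0 ℤ.* B)
        ℤ.- (Q ℤ.* (+ 0 ℤ.- B) ℤ.+ + 0 ℤ.* (M ℤ.- A) ℤ.+ + 0 ℤ.* (+ 0 ℤ.- B)) ≡ (P ℤ.+ Q) ℤ.* B
      identity = solve-∀

    2R₊+I₊ : (+ 2) ℤ.* R₊ ℤ.+ I₊ ≡ (P ℤ.- Q) ℤ.* L' ℤ.+ (+ 2) ℤ.* Q ℤ.* M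
    2R₊+I₊ = identity P Q A B M
      where
      identity : ∀ P Q A B M → (+ 2) ℤ.* ((P ℤ.* A ℤ.+ + 0 ℤ.* B) ℤ.- (+ 0 ℤ.- (Q ℤ.* (M ℤ.- A) ℤ.+ + 0 ℤ.* (+ 0 ℤ.- B))))
        ℤ.+ ((P ℤ.* B ℤ.+ + 0 ℤ.* A ℤ.+ + 0 ℤ.* B) ℤ.- (+ 0 ℤ.- (Q ℤ.* (+ 0 ℤ.- B) ℤ.+ + 0 ℤ.* (M ℤ.- A) ℤ.+ + 0 ℤ.* (+ 0 ℤ.- B))))
        ≡ (P ℤ.- Q) ℤ.* ((+ 2) ℤ.* A ℤ.+ B) ℤ.+ (+ 2) ℤ.* Q ℤ.* M
      identity = solve-∀

    I₊≡ : I₊ ≡ (P ℤ.- Q) ℤ.* B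
    I₊≡ = identity P Q A B M
      where
      identity : ∀ P Q A B M → (P ℤ.* B ℤ.+ + 0 ℤ.* A ℤ.+ + 0 ℤ.* B)
        ℤ.- (+ 0 ℤ.- (Q ℤ.* (+ 0 ℤ.- B) ℤ.+ + 0 ℤ.* (M ℤ.- A) ℤ.+ + 0 ℤ.* (+ 0 ℤ.- B))) ≡ (P ℤ.- Q) ℤ.* B
      identity = solve-∀

    m≤L : m ≤ L
    m≤L = subst (m ≤_) m+D≡L (m≤m+n m D)

    D<L : D < L
    D<L = ≤-trans (≤-trans (s≤s (ℕP.m≤n*m D 2)) (ℕP.≤-reflexive (+-comm 1 (2 * D))))
                  (≤-trans (ℕP.m≤m*n (2 * D + 1) q {{ℕ.>-nonZero q≥1}}) D-small)

    m≥1 : 1 ≤ m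
    m≥1 = m+D≡L⇒1≤m m D L m+D≡L D<L
      where
      m+D≡L⇒1≤m : ∀ m D L → m + D ≡ L → D < L → 1 ≤ m
      m+D≡L⇒1≤m zero D L e lt = ⊥-elim (ℕP.<-irrefl e lt)
      m+D≡L⇒1≤m (suc m) D L e lt = s≤s z≤n

    L≥2 : 2 ≤ L
    L≥2 = ≤-trans (s≤s (≤-trans p≥1 (m≤m+n p q))) p+q<L

    y-x-positive : Positive (y ⊖ x)
    y-x-positive with positive-suc _ (ℕP.*-mono-≤ (≤-trans p≥1 (m≤m+n p q)) b≥1) | (2 * q * m) ℕP.≤? ((p + q) * L)
    ... | i , i≡ | yes 2qm≤[p+q]L with m≤n⇒∃[o]m+o≡n 2qm≤[p+q]L
    ...   | r , r≡ = positive-nonneg-pos r i 2R+I (trans I₋≡ (cong +_ i≡))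
      where
      2R+I : (+ 2) ℤ.* R₋ ℤ.+ I₋ ≡ + r
      2R+I = trans 2R₋+I₋ (trans (cong₂ ℤ._-_ (sym +[p+q]L) (sym +2qm))
                                 (+≡⇒-≡ (+ (2 * q * m)) (+ r) (+ ((p + q) * L)) (trans (sym (ℤP.pos-+ _ r)) (cong +_ r≡))))
    y-x-positive | i , i≡ | no 2qm≰[p+q]L with m≤n⇒∃[o]m+o≡n (ℕP.≰⇒> 2qm≰[p+q]L)
    ...   | r , r≡ = positive-neg-pos r i 2R+I (trans I₋≡ (cong +_ i≡)) (subst (λ t → suc r * suc r < 5 * (t * t)) i≡ squares)
      where
      2R+I : (+ 2) ℤ.* R₋ ℤ.+ I₋ ≡ -[1+ r ]
      2R+I = trans 2R₋+I₋ (trans (cong₂ ℤ._-_ (sym +[p+q]L) (sym +2qm))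
                                 (+≡⇒-≡- (+ ((p + q) * L)) (+ suc r) (+ (2 * q * m))
                                         (trans (sym (ℤP.pos-+ _ (suc r))) (cong +_ (trans (ℕP.+-suc _ r) r≡)))))
      squares : suc r * suc r < 5 * (((p + q) * b) * ((p + q) * b))
      squares = squareBound-y-x p q L b m (suc r) p≥1 m≤L p+q<L L²≤5b²+4 (trans (+-comm (suc r) _) (trans (ℕP.+-suc _ r) r≡))

    y+x-positive-q≤p : q ≤ p → Positive (y ⊖ (0φ ⊖ x))
    y+x-positive-q≤p q≤p with m≤n⇒∃[o]m+o≡n q≤p
    ... | t , q+t≡p with positive-suc (t * L + 2 * q * m)
                                      (≤-trans (ℕP.*-mono-≤ (ℕP.*-mono-≤ {1} {2} (s≤s z≤n) q≥1) m≥1) (m≤n+m _ (t * L)))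
    ...   | r , r≡ = positive-pos-nonneg r (t * b) 2R+I I≡
      where
      P-Q≡t : P ℤ.- Q ≡ + t
      P-Q≡t = +≡⇒-≡ Q (+ t) P (trans (sym (ℤP.pos-+ q t)) (cong +_ q+t≡p))
      2R+I : (+ 2) ℤ.* R₊ ℤ.+ I₊ ≡ + suc r
      2R+I = trans 2R₊+I₊ (trans (cong (λ z → z ℤ.* L' ℤ.+ (+ 2) ℤ.* Q ℤ.* M) P-Q≡t)
               (trans (sym (trans (ℤP.pos-+ (t * L) (2 * q * m))
                                  (cong₂ ℤ._+_ (trans (ℤP.pos-* t L) (cong (+ t ℤ.*_) +L)) +2qm)))
                      (cong +_ r≡)))
      I≡ : I₊ ≡ + (t * b)
      I≡ = trans I₊≡ (trans (cong (ℤ._* B) P-Q≡t) (sym (ℤP.pos-* t b)))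

    2qD≤[p+q]L : 2 * q * D ≤ (p + q) * L
    2qD≤[p+q]L = ≤-trans (m≤m+n _ q)
                   (≤-trans (≤-trans (ℕP.≤-reflexive (identity q D)) D-small)
                            (ℕP.m≤n*m L (p + q) {{ℕ.>-nonZero (≤-trans p≥1 (m≤m+n p q))}}))
      where
      identity : ∀ q D → 2 * q * D + q ≡ (2 * D + 1) * q
      identity = NS.solve-∀

    y+x-positive-gap : ∀ t' → p + suc t' ≡ q → Positive (y ⊖ (0φ ⊖ x))
    y+x-positive-gap t' p+t≡q with m≤n⇒∃[o]m+o≡n 2qD≤[p+q]L
    ... | v , v≡ with squareBound-y+x p (suc t') L b D v p≥1 (s≤s z≤n) L≥2 5b²≤L²+4
                        (subst (λ z → (2 * D + 1) * z ≤ L) (sym p+t≡q) D-small)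
                        (subst (λ z → v + 2 * z * D ≡ (p + z) * L) (sym p+t≡q) (trans (+-comm v _) v≡))
    ...   | tL+t≤v , 5[tb]²<v² with positive-suc v (≤-trans (s≤s z≤n) (≤-trans (m≤n+m (suc t') (suc t' * L)) tL+t≤v))
                                 | positive-suc (suc t' * b) (ℕP.*-mono-≤ {1} {suc t'} (s≤s z≤n) b≥1)
    ...     | r , refl | u , u≡ = positive-pos-neg r u 2R+I I≡ (subst (λ z → 5 * (z * z) < suc r * suc r) u≡ 5[tb]²<v²)
      where
      t = suc t'
      P-Q≡-t : P ℤ.- Q ≡ ℤ.- (+ t)
      P-Q≡-t = +≡⇒-≡- P (+ t) Q (trans (sym (ℤP.pos-+ p t)) (cong +_ p+t≡q))
      I≡ : I₊ ≡ -[1+ u ]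
      I≡ = trans I₊≡ (trans (cong (ℤ._* B) P-Q≡-t)
             (trans (sym (ℤP.neg-distribˡ-* (+ t) B)) (cong ℤ.-_ (trans (sym (ℤP.pos-* t b)) (cong +_ u≡)))))
      m+D-L≡0 : (M ℤ.+ + D) ℤ.- L' ≡ + 0
      m+D-L≡0 = ≡⇒-≡0 (M ℤ.+ + D) L' (trans (sym (ℤP.pos-+ m D)) (trans (cong +_ m+D≡L) +L))
      v+2qD-[p+q]L≡0 : (+ suc r ℤ.+ (+ 2) ℤ.* Q ℤ.* + D) ℤ.- (P ℤ.+ Q) ℤ.* L' ≡ + 0
      v+2qD-[p+q]L≡0 = ≡⇒-≡0 _ _
        (trans (cong (λ z → + suc r ℤ.+ z) (sym (trans (ℤP.pos-* (2 * q) D) (cong (ℤ._* + D) (ℤP.pos-* 2 q)))))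
               (trans (sym (ℤP.pos-+ (suc r) (2 * q * D))) (trans (cong +_ (trans (+-comm (suc r) _) v≡)) +[p+q]L)))
      regroup : ∀ P Q L M D V → (P ℤ.- Q) ℤ.* L ℤ.+ (+ 2) ℤ.* Q ℤ.* M
        ≡ V ℤ.- ((V ℤ.+ (+ 2) ℤ.* Q ℤ.* D) ℤ.- (P ℤ.+ Q) ℤ.* L) ℤ.+ (+ 2) ℤ.* Q ℤ.* ((M ℤ.+ D) ℤ.- L)
      regroup = solve-∀
      cancel : ∀ V Q → V ℤ.- + 0 ℤ.+ (+ 2) ℤ.* Q ℤ.* + 0 ≡ V
      cancel = solve-∀
      2R+I : (+ 2) ℤ.* R₊ ℤ.+ I₊ ≡ + suc r
      2R+I = trans 2R₊+I₊ (trans (regroup P Q L' M (+ D) (+ suc r))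
               (trans (cong₂ (λ z w → + suc r ℤ.- z ℤ.+ (+ 2) ℤ.* Q ℤ.* w) v+2qD-[p+q]L≡0 m+D-L≡0) (cancel (+ suc r) Q)))

    y+x-positive : Positive (y ⊖ (0φ ⊖ x))
    y+x-positive with q ℕP.≤? p
    ... | yes q≤p = y+x-positive-q≤p q≤p
    ... | no q≰p with m≤n⇒∃[o]m+o≡n (ℕP.≰⇒> q≰p)
    ...   | t' , e = y+x-positive-gap t' (trans (ℕP.+-suc p t') e)

    |x|<y : AbsLt x y
    |x|<y = y-x-positive , y+x-positive


module LucasGrowth where

  open import Data.Nat as ℕ using (ℕ; zero; suc; _+_; _*_; _^_; _≤_; _<_; z≤n; s≤s; ⌊_/2⌋)
  open import Data.Nat.Properties
  open import Data.Nat.Tactic.RingSolver using (solve-∀)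
  open import Data.Product using (_×_; _,_)
  open import Data.Sum using (_⊎_; inj₁; inj₂)
  open import Relation.Binary.PropositionalEquality using (_≡_; refl; sym; trans; cong; subst; module ≡-Reasoning)
  open AdmissibleWords using (fib; lucas)
  open FiniteSums

  lucas-suc-suc : ∀ j → lucas (suc (suc j)) ≡ lucas (suc j) + lucas j
  lucas-suc-suc zero = refl
  lucas-suc-suc (suc j) = +-interchangeℕ (fib (suc (suc (suc j)))) (fib (suc (suc j))) (fib (suc j)) (fib j)

  lucas≥1 : ∀ j → 1 ≤ lucas j
  lucas≥1 zero = s≤s z≤n
  lucas≥1 (suc zero) = s≤s z≤n
  lucas≥1 (suc (suc j)) = subst (1 ≤_) (sym (lucas-suc-suc j)) (≤-trans (lucas≥1 (suc j)) (m≤m+n _ _))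

  lucas-step : ∀ j → 1 ≤ j → lucas j ≤ lucas (suc j)
  lucas-step (suc j) _ = subst (lucas (suc j) ≤_) (sym (lucas-suc-suc j)) (m≤m+n _ _)

  lucas-mono : ∀ i j → 1 ≤ i → i ≤ j → lucas i ≤ lucas j
  lucas-mono i j i≥1 i≤j with m≤n⇒∃[o]m+o≡n i≤j
  ... | o , refl = lucas-+ o
    where
    lucas-+ : ∀ o → lucas i ≤ lucas (i + o)
    lucas-+ zero = ≤-reflexive (cong lucas (sym (+-identityʳ i)))
    lucas-+ (suc o) = ≤-trans (lucas-+ o)
      (subst (λ t → lucas (i + o) ≤ lucas t) (sym (+-suc i o)) (lucas-step (i + o) (≤-trans i≥1 (m≤m+n i o))))

  n≤lucas : ∀ n → n ≤ lucas n
  n≤lucas zero = z≤n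
  n≤lucas (suc zero) = s≤s z≤n
  n≤lucas (suc (suc n)) = subst (suc (suc n) ≤_) (sym (lucas-suc-suc n))
    (subst (_≤ lucas (suc n) + lucas n) (+-comm (suc n) 1) (+-mono-≤ (n≤lucas (suc n)) (lucas≥1 n)))

  lucas-double : ∀ j → 1 ≤ j → 2 * lucas j ≤ lucas (j + 2)
  lucas-double (suc j) _ = begin
    2 * lucas (suc j)                   ≡⟨ cong (lucas (suc j) +_) (+-identityʳ _) ⟩
    lucas (suc j) + lucas (suc j)       ≤⟨ +-monoˡ-≤ (lucas (suc j)) (lucas-step (suc j) (s≤s z≤n)) ⟩
    lucas (suc (suc j)) + lucas (suc j) ≡⟨ sym (lucas-suc-suc (suc j)) ⟩
    lucas (suc (suc (suc j)))           ≡⟨ cong (λ t → lucas (suc t)) (+-comm 2 j) ⟩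
    lucas (suc j + 2)                   ∎
    where open ≤-Reasoning

  lucas-pow-double : ∀ j t → 1 ≤ j → 2 ^ t * lucas j ≤ lucas (j + 2 * t)
  lucas-pow-double j zero j1 = ≤-reflexive (trans (+-identityʳ (lucas j)) (cong lucas (sym (+-identityʳ j))))
  lucas-pow-double j (suc t) j1 = begin
    2 ^ suc t * lucas j   ≡⟨ *-assoc 2 (2 ^ t) (lucas j) ⟩
    2 * (2 ^ t * lucas j) ≤⟨ *-monoʳ-≤ 2 (lucas-pow-double j t j1) ⟩
    2 * lucas (j + 2 * t) ≤⟨ lucas-double (j + 2 * t) (≤-trans j1 (m≤m+n j _)) ⟩
    lucas (j + 2 * t + 2) ≡⟨ cong lucas (identity j t) ⟩
    lucas (j + 2 * suc t) ∎
    where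
    open ≤-Reasoning
    identity : ∀ j t → j + 2 * t + 2 ≡ j + 2 * suc t
    identity = solve-∀

  n<2^n : ∀ x → x < 2 ^ x
  n<2^n zero = s≤s z≤n
  n<2^n (suc x) = begin-strict
    suc x         ≤⟨ n<2^n x ⟩
    2 ^ x         ≡⟨ sym (+-identityʳ _) ⟩
    2 ^ x + 0     <⟨ +-monoʳ-< (2 ^ x) (m^n>0 2 x) ⟩
    2 ^ x + 2 ^ x ≡⟨ cong (2 ^ x +_) (sym (+-identityʳ _)) ⟩
    2 ^ suc x     ∎
    where open ≤-Reasoning

  sum-lucas+3 : ∀ K → sumℕ K (λ j → lucas (suc j)) + 3 ≡ lucas (K + 2)
  sum-lucas+3 zero = refl
  sum-lucas+3 (suc K) = begin
    (S + lucas (suc K)) + 3             ≡⟨ identity S (lucas (suc K)) ⟩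
    (S + 3) + lucas (suc K)             ≡⟨ cong (_+ lucas (suc K)) (sum-lucas+3 K) ⟩
    lucas (K + 2) + lucas (suc K)       ≡⟨ cong (λ a → lucas a + lucas (suc K)) (+-comm K 2) ⟩
    lucas (suc (suc K)) + lucas (suc K) ≡⟨ sym (lucas-suc-suc (suc K)) ⟩
    lucas (suc (suc (suc K)))           ≡⟨ cong lucas (sym (+-comm (suc K) 2)) ⟩
    lucas (suc K + 2)                   ∎
    where
    open ≡-Reasoning
    S = sumℕ K (λ j → lucas (suc j))
    identity : ∀ a b → (a + b) + 3 ≡ (a + 3) + b
    identity = solve-∀

  ⌊n/2⌋+⌊n/2⌋≤n : ∀ n → ⌊ n /2⌋ + ⌊ n /2⌋ ≤ n
  ⌊n/2⌋+⌊n/2⌋≤n zero = z≤n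
  ⌊n/2⌋+⌊n/2⌋≤n (suc zero) = z≤n
  ⌊n/2⌋+⌊n/2⌋≤n (suc (suc n)) = s≤s (subst (_≤ suc n) (sym (+-suc (⌊ n /2⌋) (⌊ n /2⌋))) (s≤s (⌊n/2⌋+⌊n/2⌋≤n n)))

  n≤1+⌊n/2⌋+⌊n/2⌋ : ∀ n → n ≤ suc (⌊ n /2⌋ + ⌊ n /2⌋)
  n≤1+⌊n/2⌋+⌊n/2⌋ zero = z≤n
  n≤1+⌊n/2⌋+⌊n/2⌋ (suc zero) = s≤s z≤n
  n≤1+⌊n/2⌋+⌊n/2⌋ (suc (suc n)) =
    s≤s (subst (suc n ≤_) (sym (cong suc (+-suc (⌊ n /2⌋) (⌊ n /2⌋)))) (s≤s (n≤1+⌊n/2⌋+⌊n/2⌋ n)))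

  -- Cassini's identity b² − ab − a² = ±1 for consecutive Fibonacci numbers, moved so that no subtraction occurs.
  Cassini : ℕ → ℕ → Set
  Cassini a b = (a * a + a * b + 1 ≡ b * b) ⊎ (a * a + a * b ≡ b * b + 1)

  fib-cassini : ∀ k → Cassini (fib k) (fib (suc k))
  fib-cassini zero = inj₁ refl
  fib-cassini (suc k) = next (fib k) (fib (suc k)) (fib-cassini k)
    where
    next : ∀ a b → Cassini a b → Cassini b (b + a)
    next a b (inj₁ e) = inj₂ (trans (identity₁ a b) (trans (cong (λ t → b * b + a * b + t) (sym e)) (identity₂ a b)))
      where
      identity₁ : ∀ a b → b * b + b * (b + a) ≡ b * b + a * b + b * b
      identity₁ = solve-∀
      identity₂ : ∀ a b → b * b + a * b + (a * a + a * b + 1) ≡ (b + a) * (b + a) + 1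
      identity₂ = solve-∀
    next a b (inj₂ e) = inj₁ (trans (identity₁ a b) (trans (cong (λ t → b * b + a * b + t) (sym e)) (identity₂ a b)))
      where
      identity₁ : ∀ a b → b * b + b * (b + a) + 1 ≡ b * b + a * b + (b * b + 1)
      identity₁ = solve-∀
      identity₂ : ∀ a b → b * b + a * b + (a * a + a * b) ≡ (b + a) * (b + a)
      identity₂ = solve-∀

  lucas²-cassini : ∀ k → ((2 * fib k + fib (suc k)) * (2 * fib k + fib (suc k)) ≤ 5 * (fib (suc k) * fib (suc k)) + 4)
                × (5 * (fib (suc k) * fib (suc k)) ≤ (2 * fib k + fib (suc k)) * (2 * fib k + fib (suc k)) + 4)
  lucas²-cassini k = bounds (fib k) (fib (suc k)) (fib-cassini k)
    where
    bounds : ∀ a b → Cassini a b → ((2 * a + b) * (2 * a + b) ≤ 5 * (b * b) + 4) × (5 * (b * b) ≤ (2 * a + b) * (2 * a + b) + 4)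
    bounds a b (inj₁ e) = ≤-trans (m≤m+n _ 4) (≤-trans (≤-reflexive eq) (m≤m+n _ 4)) , ≤-reflexive (sym eq)
      where
      identity₁ : ∀ a b → (2 * a + b) * (2 * a + b) + 4 ≡ 4 * (a * a + a * b + 1) + b * b
      identity₁ = solve-∀
      identity₂ : ∀ b → 4 * (b * b) + b * b ≡ 5 * (b * b)
      identity₂ = solve-∀
      eq : (2 * a + b) * (2 * a + b) + 4 ≡ 5 * (b * b)
      eq = trans (identity₁ a b) (trans (cong (λ t → 4 * t + b * b) e) (identity₂ b))
    bounds a b (inj₂ e) = ≤-reflexive eq , ≤-trans (m≤m+n (5 * (b * b)) 4) (≤-trans (≤-reflexive (sym eq)) (m≤m+n _ 4))
      where
      identity₁ : ∀ a b → (2 * a + b) * (2 * a + b) ≡ 4 * (a * a + a * b) + b * b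
      identity₁ = solve-∀
      identity₂ : ∀ b → 4 * (b * b + 1) + b * b ≡ 5 * (b * b) + 4
      identity₂ = solve-∀
      eq : (2 * a + b) * (2 * a + b) ≡ 5 * (b * b) + 4
      eq = trans (identity₁ a b) (trans (cong (λ t → 4 * t + b * b) e) (identity₂ b))

  fib-suc≥1 : ∀ k → 1 ≤ fib (suc k)
  fib-suc≥1 zero = s≤s z≤n
  fib-suc≥1 (suc k) = ≤-trans (fib-suc≥1 k) (m≤m+n _ _)

  lucas-suc≡2fib+fib : ∀ k → lucas (suc k) ≡ 2 * fib k + fib (suc k)
  lucas-suc≡2fib+fib k = identity (fib (suc k)) (fib k)
    where
    identity : ∀ x y → (x + y) + y ≡ 2 * y + x
    identity = solve-∀


module CycleCount where

  open import Defs
  open ParityVector using (fromParity)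
  open CycleCorrespondence using (module FromShiftClassReps)
  open PeriodicWords using (cycle)
  open WordEnumeration using (ιd; ιd-yes; ιd-no; ιd*≤)
  open Necklaces using (module OfLength)
  open PrimitivePeriods using (exactWordCount; module ByExactPeriod)
  open AdmissibleWords using (fib; lucas; admissibleWords≡lucas)
  open FiniteSums
  open MobiusDivisorSum using (ιℤ)
  open MobiusInversion using (module Inversion)
  open LucasInZφ using (φ^suc-fib; mobiusSum≡embed-sumℤ)
  open ZφOrder using (module AbsLtBound)
  open LucasGrowth
  open import Data.Nat as ℕ using (ℕ; zero; suc; _≤_; _<_; _*_; _+_; _^_; s≤s; z≤n; ⌊_/2⌋)
  open import Data.Nat.Properties
  open import Data.Nat.Divisibility using (_∣_; _∣?_; divides; ∣-refl)
  open import Data.Nat.Tactic.RingSolver using (solve-∀)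
  open import Data.Integer as ℤ using (+_)
  import Data.Integer.Properties as ℤP
  open import Data.List using (List; length; map)
  open import Data.List.Properties using (length-map)
  open import Data.Product using (Σ; _×_; _,_; proj₁; proj₂)
  open import Data.Sum using (inj₁; inj₂)
  open import Data.Empty using (⊥-elim)
  open import Relation.Binary.PropositionalEquality using (_≡_; refl; sym; trans; cong; subst; module ≡-Reasoning)

  -- The value at 0 is never used: the theorem concerns n ≥ 1 only.
  cycleCount : ℕ → ℕ
  cycleCount zero = 0
  cycleCount (suc m) = length (OfLength.leastRotations (suc m))

  properDivisorSum : ℕ → ℕ
  properDivisorSum k = sumℕ k (λ j → ιd (suc j ∣? suc k) * exactWordCount j)

  -- Admissible cyclic words of length N are counted by lucas N; sort them by exact period.
  lucas≡divisorSum : ∀ N → 1 ≤ N → lucas N ≡ sumℕ N (λ j → ιd (suc j ∣? N) * exactWordCount j)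
  lucas≡divisorSum (suc M) _ = trans (sym (admissibleWords≡lucas M)) (ByExactPeriod.admissibleWords-by-exactPeriod (suc M))

  n*cycleCount≡exactWordCount : ∀ k → suc k * cycleCount (suc k) ≡ exactWordCount k
  n*cycleCount≡exactWordCount k = OfLength.period*count≡exactWords (suc k)

  n*cycleCount≡mobius : ∀ m → + (suc m * cycleCount (suc m)) ≡
    sumℤ (suc m) (λ k → ιℤ (suc k ∣? suc m) ℤ.* (μ (suc k) ℤ.* + lucas (suc m ℕ./ suc k)))
  n*cycleCount≡mobius m = trans (cong +_ (n*cycleCount≡exactWordCount m))
    (sym (Inversion.mobiusInversion (λ N → + lucas N) (λ d → + exactWordCount (ℕ.pred d)) lucas≡divisorSumℤ m))
    where
    lucas≡divisorSumℤ : ∀ N → 1 ≤ N → + lucas N ≡ sumℤ N (λ j → ιℤ (suc j ∣? N) ℤ.* + exactWordCount j)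
    lucas≡divisorSumℤ N N≥1 = trans (cong +_ (lucas≡divisorSum N N≥1))
      (trans (sumℕ-ℤ N _) (sumℤ-cong N (λ j _ → ℤP.pos-* (ιd (suc j ∣? N)) (exactWordCount j))))

  cycles-and-mobiusFormula : ∀ n → 1 ≤ n →
    Σ (List ℤ₂) (λ L → CyclesOfLength n L × length L ≡ cycleCount n) × embed (+ (n * cycleCount n)) ≡ mobiusSum n
  cycles-and-mobiusFormula (suc m) n≥1 =
    (map fromParity (map cycle roots) , FromShiftClassReps.cycles n≥1 (OfLength.shiftClassReps (suc m)) ,
     trans (length-map fromParity (map cycle roots)) (length-map cycle roots)) ,
    trans (cong embed (n*cycleCount≡mobius m)) (sym (mobiusSum≡embed-sumℤ (suc m)))
    where roots = OfLength.leastRotations (suc m)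

  lastTerm : ∀ k → ιd (suc k ∣? suc k) * exactWordCount k ≡ exactWordCount k
  lastTerm k = trans (cong (_* exactWordCount k) (ιd-yes (suc k ∣? suc k) ∣-refl)) (+-identityʳ (exactWordCount k))

  n*cycleCount+properDivisorSum≡lucas : ∀ k → suc k * cycleCount (suc k) + properDivisorSum k ≡ lucas (suc k)
  n*cycleCount+properDivisorSum≡lucas k = begin
    suc k * cycleCount (suc k) + properDivisorSum k ≡⟨ cong (_+ properDivisorSum k) (n*cycleCount≡exactWordCount k) ⟩
    exactWordCount k + properDivisorSum k           ≡⟨ +-comm (exactWordCount k) _ ⟩
    properDivisorSum k + exactWordCount k           ≡⟨ cong (λ t → properDivisorSum k + t) (sym (lastTerm k)) ⟩
    sumℕ (suc k) (λ j → ιd (suc j ∣? suc k) * exactWordCount j) ≡⟨ sym (lucas≡divisorSum (suc k) (s≤s z≤n)) ⟩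
    lucas (suc k) ∎
    where open ≡-Reasoning

  exactWordCount≤lucas : ∀ k → exactWordCount k ≤ lucas (suc k)
  exactWordCount≤lucas k = subst (exactWordCount k ≤_) (n*cycleCount+properDivisorSum≡lucas k)
    (subst (_≤ suc k * cycleCount (suc k) + properDivisorSum k) (n*cycleCount≡exactWordCount k) (m≤m+n _ _))

  2≤quotient : ∀ c j n → n ≡ c * suc j → suc j < n → 2 ≤ c
  2≤quotient zero j n refl lt = ⊥-elim (<⇒≱ lt z≤n)
  2≤quotient (suc zero) j n refl lt = ⊥-elim (<-irrefl (sym (+-identityʳ (suc j))) lt)
  2≤quotient (suc (suc _)) j n _ _ = s≤s (s≤s z≤n)

  proper-∣⇒≤⌊/2⌋ : ∀ j n → suc j ∣ n → suc j < n → suc j ≤ ⌊ n /2⌋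
  proper-∣⇒≤⌊/2⌋ j n (divides c n≡cd) d<n with ≤-<-connex (suc j) (⌊ n /2⌋)
  ... | inj₁ d≤h = d≤h
  ... | inj₂ h<d = ⊥-elim (1+n≰n (subst (_≤ suc (j + j)) (cong suc (+-suc j j))
                                 (≤-trans 2d≤n (≤-trans (n≤1+⌊n/2⌋+⌊n/2⌋ n) (s≤s (+-mono-≤ h≤j h≤j))))))
    where
    h≤j : ⌊ n /2⌋ ≤ j
    h≤j = ≤-pred h<d
    2d≤n : suc j + suc j ≤ n
    2d≤n = subst (suc j + suc j ≤_) (sym n≡cd)
             (≤-trans (≤-reflexive (cong (λ t → suc j + t) (sym (+-identityʳ (suc j)))))
                      (*-monoˡ-≤ (suc j) (2≤quotient c j n n≡cd d<n)))

  -- Only divisors up to n/2 are proper, so the proper part is bounded by a Lucas number of half the index.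
  properDivisorSum≤lucas-half : ∀ k → properDivisorSum k ≤ lucas (⌊ suc k /2⌋ + 2)
  properDivisorSum≤lucas-half k with m≤n⇒∃[o]m+o≡n (≤-pred (⌊n/2⌋<n k))
  ... | o , h+o≡k = begin
    sumℕ k g                              ≡⟨ cong (λ t → sumℕ t g) (sym h+o≡k) ⟩
    sumℕ (h + o) g                        ≡⟨ sumℕ-split h o g ⟩
    sumℕ h g + sumℕ o (λ i → g (h + i))   ≡⟨ cong (λ t → sumℕ h g + t) (sumℕ-zero o upperHalf) ⟩
    sumℕ h g + 0                          ≡⟨ +-identityʳ _ ⟩
    sumℕ h g                              ≤⟨ sumℕ-mono-≤ h (λ j _ → ≤-trans (ιd*≤ (suc j ∣? suc k) _) (exactWordCount≤lucas j)) ⟩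
    sumℕ h (λ j → lucas (suc j))          ≤⟨ m≤m+n _ 3 ⟩
    sumℕ h (λ j → lucas (suc j)) + 3      ≡⟨ sum-lucas+3 h ⟩
    lucas (h + 2)                         ∎
    where
    open ≤-Reasoning
    h = ⌊ suc k /2⌋
    g = λ j → ιd (suc j ∣? suc k) * exactWordCount j
    upperHalf : ∀ i → i < o → g (h + i) ≡ 0
    upperHalf i i<o = cong (_* exactWordCount (h + i)) (ιd-no (suc (h + i) ∣? suc k) λ d →
      1+n≰n (≤-trans (s≤s (m≤m+n h i))
                     (proper-∣⇒≤⌊/2⌋ (h + i) (suc k) d (s≤s (subst (h + i <_) h+o≡k (+-monoʳ-< h i<o))))))

  -- Beyond n ≥ 12q + p + q + 6 the hypotheses of ZφOrder.AbsLtBound hold, where L = lucas n.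
  module Threshold (p q k : ℕ) (n≥N : 12 * q + p + q + 6 ≤ suc k) where

    L = lucas (suc k)
    h = ⌊ suc k /2⌋
    Λ = lucas (h + 2)

    p+q<L : suc (p + q) ≤ L
    p+q<L = ≤-trans (subst (suc (p + q) ≤_) (identity p q) (m≤m+n _ (12 * q + 5))) (≤-trans n≥N (n≤lucas (suc k)))
      where
      identity : ∀ p q → suc (p + q) + (12 * q + 5) ≡ 12 * q + p + q + 6
      identity = solve-∀

    h+2+6q≤n : h + 2 + 2 * (3 * q) ≤ suc k
    h+2+6q≤n = *-cancelˡ-≤ 2 (begin
      2 * (h + 2 + 2 * (3 * q)) ≡⟨ identity h q ⟩
      (h + h) + (12 * q + 4)    ≤⟨ +-mono-≤ (⌊n/2⌋+⌊n/2⌋≤n (suc k)) (≤-trans (subst (12 * q + 4 ≤_) (identity′ q p) (m≤m+n _ _)) n≥N) ⟩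
      suc k + suc k             ≡⟨ sym (identity″ (suc k)) ⟩
      2 * suc k                 ∎)
      where
      open ≤-Reasoning
      identity : ∀ h q → 2 * (h + 2 + 2 * (3 * q)) ≡ (h + h) + (12 * q + 4)
      identity = solve-∀
      identity′ : ∀ q p → 12 * q + 4 + (p + q + 2) ≡ 12 * q + p + q + 6
      identity′ = solve-∀
      identity″ : ∀ n → 2 * n ≡ n + n
      identity″ = solve-∀

    D-small : (2 * properDivisorSum k + 1) * q ≤ L
    D-small = begin
      (2 * properDivisorSum k + 1) * q ≤⟨ *-monoˡ-≤ q (+-monoˡ-≤ 1 (*-monoʳ-≤ 2 (properDivisorSum≤lucas-half k))) ⟩
      (2 * Λ + 1) * q              ≤⟨ *-monoˡ-≤ q (+-monoʳ-≤ (2 * Λ) (lucas≥1 (h + 2))) ⟩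
      (2 * Λ + Λ) * q              ≡⟨ identity Λ q ⟩
      (3 * q) * Λ                  ≤⟨ *-monoˡ-≤ Λ (<⇒≤ (n<2^n (3 * q))) ⟩
      2 ^ (3 * q) * Λ              ≤⟨ lucas-pow-double (h + 2) (3 * q) 1≤h+2 ⟩
      lucas (h + 2 + 2 * (3 * q))  ≤⟨ lucas-mono _ (suc k) (≤-trans 1≤h+2 (m≤m+n _ _)) h+2+6q≤n ⟩
      L                            ∎
      where
      open ≤-Reasoning
      1≤h+2 : 1 ≤ h + 2
      1≤h+2 = ≤-trans (s≤s z≤n) (m≤n+m 2 h)
      identity : ∀ Λ q → (2 * Λ + Λ) * q ≡ (3 * q) * Λ
      identity = solve-∀

  cycleCount-asymptotic : AsymptoticPhiOverN cycleCount
  cycleCount-asymptotic p q p≥1 q≥1 = 12 * q + p + q + 6 , bound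
    where
    bound : ∀ n → 12 * q + p + q + 6 ≤ n →
            AbsLt (embed (+ q) ⊗ (embed (+ (n * cycleCount n)) ⊖ (φ ^φ n))) (embed (+ p) ⊗ (φ ^φ n))
    bound zero N≤0 with () ← ≤-trans (m≤n+m 6 (12 * q + p + q)) N≤0
    bound (suc k) N≤n = subst (λ z → AbsLt (embed (+ q) ⊗ (embed (+ m) ⊖ z)) (embed (+ p) ⊗ z)) (sym (φ^suc-fib k))
      (AbsLtBound.|x|<y p q (fib k) (fib (suc k)) m (properDivisorSum k) p≥1 q≥1 (fib-suc≥1 k)
        (trans (n*cycleCount+properDivisorSum≡lucas k) L≡2a+b) (proj₁ (lucas²-cassini k)) (proj₂ (lucas²-cassini k))
        (subst (suc (p + q) ≤_) L≡2a+b (Threshold.p+q<L p q k N≤n))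
        (subst ((2 * properDivisorSum k + 1) * q ≤_) L≡2a+b (Threshold.D-small p q k N≤n)))
      where
      m = suc k * cycleCount (suc k)
      L≡2a+b = lucas-suc≡2fib+fib k


open import Defs
open import Data.Nat using (ℕ; _≤_; _*_)
open import Data.Integer using (+_)
open import Data.List using (List; length)
open import Data.Product using (Σ; _×_; _,_)
open import Relation.Binary.PropositionalEquality using (_≡_)

theorem1p4 : Σ (ℕ → ℕ) λ Z →
    (∀ n → 1 ≤ n →
    Σ (List ℤ₂) (λ L → CyclesOfLength n L × length L ≡ Z n)
    × embed (+ (n * Z n)) ≡ mobiusSum n)
    × AsymptoticPhiOverN Z
theorem1p4 = cycleCount , cycles-and-mobiusFormula , cycleCount-asymptotic
  where open CycleCount
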